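{- Let $\beta$ be a primitive $p^2$-th root of unity in an extension field of $\mathbb{F}_2$ and let $s(x)=\sum_{i=0}^{p^2-1}s_ix^i\in\mathbb{F}_2[x]$ for the sequence $\mathbf{s}^\infty$ defined in the context. Then for every $0\le k\le pf-1$ and $a\in\mathbb{Z}_{p^2}$, \[s(\beta^a)=\begin{cases}1, & a=0,\\ 1+H_{b+k}^{(p)}(\beta), & a\in pD_k^{(p)},\\ 1+H_{b+k}^{(p)}(\beta)+H_{b+k}^{(p^2)}(\beta), & a\in D_k^{(p^2)}.\end{cases}\]
   Context: Let $p$ be an odd prime, $p-1=ef$ with $f=2^r$, $r\ge1$, and let $g$ be a primitive root modulo $p^2$. For $j\in\{1,2\}$ let $d_j=p^{j-1}f$, $D_0^{(p^j)}=\{g^{d_j t}\bmod p^j: 0\le t<e\}$, $D_i^{(p^j)}=\{g^ix\bmod p^j: x\in D_0^{(p^j)}\}$; subscripts of $D^{(p^j)}$ are taken modulo $d_j$. For $D\subseteq\mathbb{Z}_p$, $pD=\{px:x\in D\}\subseteq\mathbb{Z}_{p^2}$. For an integer $v$ set $H_v^{(p)}=\bigcup_{i=0}^{f/2-1}pD^{(p)}_{(i+v)\bmod f}\subseteq\mathbb{Z}_{p^2}$ and $H_v^{(p^2)}=\bigcup_{i=0}^{pf/2-1}D^{(p^2)}_{(i+v)\bmod pf}\subseteq\mathbb{Z}_{p^2}$. For a set $T\subseteq\mathbb{Z}_{p^2}$, $T(x)=\sum_{t\in T}x^t\in\mathbb{F}_2[x]$. Fix an integer $b$ with $0\le b\le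 pf-1$, let $C_1=\{0\}\cup H_b^{(p)}\cup H_b^{(p^2)}$, and let $s_i=1$ if $i\bmod p^2\in C_1$ and $s_i=0$ otherwise. -}

module Defs where

open import Level using (Level)
open import Data.Bool using (Bool; true; false; _∨_; _∧_; if_then_else_)
open import Data.Nat using (ℕ; zero; suc; _∸_; _+_; _*_; _^_; _%_; _/_; _≡ᵇ_; _<_; NonZero)
open import Data.List using (List; upTo; map; foldr)
open import Data.Bool.ListAction using (any)
open import Data.Nat.Properties using (m*n≢0)
open import Data.Product using (∃; _×_)
open import Relation.Binary.PropositionalEquality using (_≡_; _≢_)
open import Relation.Nullary using (¬_)
open import Algebra.Bundles using (CommutativeRing; Semiring)
import Algebra.Definitions.RawSemiring as RS

IsPrimitiveRootMod : (m ord g : ℕ) → .{{NonZero m}} → Set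
IsPrimitiveRootMod m ord g =
  ((g ^ ord) % m ≡ 1 % m) × (∀ n → 0 < n → n < ord → (g ^ n) % m ≢ 1 % m)

IsPrimitiveRootModSq : (p g : ℕ) → .{{NonZero p}} → Set
IsPrimitiveRootModSq p g = IsPrimitiveRootMod (p * p) (p * (p ∸ 1)) g {{m*n≢0 p p}}

-- D_i^{(m)} with modulus m, d = number of classes, e = class size:
-- a ∈ D_i  iff  a = g^((i mod d) + d t) mod m for some 0 ≤ t < e.
memD : (g m d e : ℕ) → .{{NonZero m}} → .{{NonZero d}} → ℕ → ℕ → Bool
memD g m d e i a = any (λ t → ((g ^ ((i % d) + d * t)) % m) ≡ᵇ a) (upTo e)

module Setup (p e f g : ℕ) .{{_ : NonZero p}} .{{_ : NonZero f}} where

  instance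
    nz-p² : NonZero (p * p)
    nz-p² = m*n≢0 p p
    nz-pf : NonZero (p * f)
    nz-pf = m*n≢0 p f

  D₁ : ℕ → ℕ → Bool
  D₁ i a = memD g p f e i a

  D₂ : ℕ → ℕ → Bool
  D₂ i a = memD g (p * p) (p * f) e i a

  pD₁ : ℕ → ℕ → Bool
  pD₁ i a = any (λ x → D₁ i x ∧ ((p * x) ≡ᵇ a)) (upTo p)

  Hp : ℕ → ℕ → Bool
  Hp v a = any (λ i → pD₁ ((i + v) % f) a) (upTo (f / 2))

  Hp² : ℕ → ℕ → Bool
  Hp² v a = any (λ i → D₂ ((i + v) % (p * f)) a) (upTo ((p * f) / 2))

  C₁ : ℕ → ℕ → Bool
  C₁ b a = (a ≡ᵇ 0) ∨ (Hp b a ∨ Hp² b a)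

  s : ℕ → ℕ → Bool
  s b i = C₁ b (i % (p * p))

  module Eval {c ℓ : Level} (R : CommutativeRing c ℓ) where
    open CommutativeRing R public using (Carrier; 0#; 1#; _≈_; semiring) renaming (_+_ to _+ᴿ_)
    open RS (Semiring.rawSemiring semiring) public using () renaming (_^_ to _^ᴿ_)

    Σ< : ℕ → (ℕ → Carrier) → Carrier
    Σ< n F = foldr (λ i acc → F i +ᴿ acc) 0# (upTo n)

    evalSet : (ℕ → Bool) → Carrier → Carrier
    evalSet T x = Σ< (p * p) (λ t → if T t then x ^ᴿ t else 0#)

    sPoly : ℕ → Carrier → Carrier
    sPoly b x = Σ< (p * p) (λ i → if s b i then x ^ᴿ i else 0#)

-- A commutative ring that is a field (1 ≠ 0, nonzero elements invertible)
-- of characteristic 2 (i.e. an extension field of 𝔽₂).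
IsFieldChar2 : {c ℓ : Level} → CommutativeRing c ℓ → Set _
IsFieldChar2 R = (¬ (1# ≈ 0#)) × (∀ x → ¬ (x ≈ 0#) → ∃ λ y → (x *ᴿ y) ≈ 1#) × ((1# +ᴿ 1#) ≈ 0#)
  where open CommutativeRing R using (_≈_; 0#; 1#; semiring) renaming (_+_ to _+ᴿ_; _*_ to _*ᴿ_)

IsPrimitiveRoot : {c ℓ : Level} (R : CommutativeRing c ℓ) → ℕ → CommutativeRing.Carrier R → Set _
IsPrimitiveRoot R n β = ((β ^ᴿ n) ≈ 1#) × (∀ m → 0 < m → m < n → ¬ ((β ^ᴿ m) ≈ 1#))
  where open CommutativeRing R using (_≈_; 0#; 1#; semiring) renaming (_+_ to _+ᴿ_; _*_ to _*ᴿ_)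
        open RS (Semiring.rawSemiring semiring) using () renaming (_^_ to _^ᴿ_)

module Submission where

-- Since {0}, H_b^(p) and H_b^(p²) are disjoint, s(x) = 1 + H_b^(p)(x) + H_b^(p²)(x), and each class
-- is the injective image of t ↦ g^(j + d t), because g has order p(p-1) modulo p² and p-1 modulo p.
-- For a = g^n mod p², replacing β by β^a multiplies every exponent by g^n and so moves each class
-- D_j to D_(j+n): both H's are shifted by n. For a = p g^n mod p, every term of H^(p) becomes 1,
-- while each class D_j^(p²) is sent onto p D_(j+n)^(p); as j runs over pf/2 consecutive indices
-- this covers the f/2 classes of H_(b+n)^(p) once plus (f/2)e full rounds of all f classes, and a
-- full round sums to the sum of the nontrivial p-th roots of unity, which is -1 = 1. In
-- characteristic 2 the constant terms then cancel in pairs.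

open import Defs
open import Level using (Level)
open import Data.Nat using (ℕ; _+_; _*_; _∸_; _^_; _<_; _≤_; NonZero)
open import Data.Nat.Primality using (Prime)
open import Data.Bool using (T)
open import Data.Product using (_×_)
open import Relation.Binary.PropositionalEquality using (_≡_)
open import Algebra.Bundles using (CommutativeRing)

open import Data.Bool using (Bool; true; false; _∨_; if_then_else_)
open import Data.Bool.Properties using (T-∨; T-∧)
open import Data.Bool.ListAction using (any)
open import Data.Empty using (⊥; ⊥-elim)
open import Data.Fin using (Fin; toℕ; fromℕ<; punchOut)
import Data.Fin.Properties as Fin
open import Data.List using (applyUpTo; foldr)
open import Data.Nat using (zero; suc; _≡ᵇ_; _%_; _/_; _≟_; z<s; s<s; nonTrivial⇒n>1)
open import Data.Nat.DivMod
open import Data.Nat.Divisibility using (_∣_; divides; ∣m⇒∣m*n; ∣⇒≤; n∣m⇒m%n≡0; m%n≡0⇒n∣m; m∣m*n)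
open import Data.Nat.Primality using (euclidsLemma; prime⇒nonTrivial)
import Data.Nat.Properties as ℕ
open import Data.Nat.Tactic.RingSolver using (solve-∀)
open import Data.Product using (∃; _,_; proj₁; proj₂)
open import Data.Sum using (inj₁; inj₂)
open import Data.Unit using (tt)
open import Function using (id; _∘_; Equivalence)
open import Relation.Binary.Definitions using (tri<; tri≈; tri>)
open import Relation.Binary.PropositionalEquality using (_≢_; refl; cong; cong₂; sym; trans; subst; module ≡-Reasoning)
open import Relation.Nullary using (¬_; yes; no)

anyBelow : ℕ → (ℕ → Bool) → Bool
anyBelow zero    Q = false
anyBelow (suc n) Q = Q 0 ∨ anyBelow n (Q ∘ suc)

any-applyUpTo : ∀ n (h : ℕ → ℕ) (Q : ℕ → Bool) → any Q (applyUpTo h n) ≡ anyBelow n (Q ∘ h)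
any-applyUpTo zero    h Q = refl
any-applyUpTo (suc n) h Q = cong (Q (h 0) ∨_) (any-applyUpTo n (h ∘ suc) Q)

anyBelow-cong : ∀ n {Q Q′ : ℕ → Bool} → (∀ i → Q i ≡ Q′ i) → anyBelow n Q ≡ anyBelow n Q′
anyBelow-cong zero    eq = refl
anyBelow-cong (suc n) eq = cong₂ _∨_ (eq 0) (anyBelow-cong n (eq ∘ suc))

anyBelow⇒∃ : ∀ n (Q : ℕ → Bool) → T (anyBelow n Q) → ∃ λ i → i < n × T (Q i)
anyBelow⇒∃ (suc n) Q q with Equivalence.to T-∨ q
... | inj₁ q₀ = 0 , z<s , q₀
... | inj₂ qs = let i , i<n , qᵢ = anyBelow⇒∃ n (Q ∘ suc) qs in suc i , s<s i<n , qᵢ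

∃⇒anyBelow : ∀ n (Q : ℕ → Bool) {i} → i < n → T (Q i) → T (anyBelow n Q)
∃⇒anyBelow (suc n) Q {zero}  _         q = Equivalence.from T-∨ (inj₁ q)
∃⇒anyBelow (suc n) Q {suc i} (s<s i<n) q = Equivalence.from T-∨ (inj₂ (∃⇒anyBelow n (Q ∘ suc) i<n q))

T-injective : ∀ {a b : Bool} → (T a → T b) → (T b → T a) → a ≡ b
T-injective {false} {false} _ _ = refl
T-injective {false} {true}  _ b⇒a = ⊥-elim (b⇒a tt)
T-injective {true}  {false} a⇒b _ = ⊥-elim (a⇒b tt)
T-injective {true}  {true}  _ _ = refl

anyBelow²⇒∃ : ∀ m e (h : ℕ → ℕ → ℕ) a →
  T (anyBelow m (λ l → anyBelow e (λ t → h l t ≡ᵇ a))) → ∃ λ l → ∃ λ t → h l t ≡ a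
anyBelow²⇒∃ m e h a q =
  let l , _ , qₗ = anyBelow⇒∃ m _ q
      t , _ , qₜ = anyBelow⇒∃ e _ qₗ
  in l , t , ℕ.≡ᵇ⇒≡ _ _ qₜ

module Arithmetic where

  open import Data.Nat.Properties
  open ≡-Reasoning

  %-cong-+ : ∀ d .{{_ : NonZero d}} {a a′ b b′} → a % d ≡ a′ % d → b % d ≡ b′ % d → (a + b) % d ≡ (a′ + b′) % d
  %-cong-+ d {a} {a′} {b} {b′} a≡a′ b≡b′ = begin
    (a + b) % d                ≡⟨ %-distribˡ-+ a b d ⟩
    (a % d + b % d) % d        ≡⟨ cong₂ (λ x y → (x + y) % d) a≡a′ b≡b′ ⟩
    (a′ % d + b′ % d) % d      ≡⟨ %-distribˡ-+ a′ b′ d ⟨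
    (a′ + b′) % d              ∎

  %-cong-*ˡ : ∀ d .{{_ : NonZero d}} z {x y} → x % d ≡ y % d → (z * x) % d ≡ (z * y) % d
  %-cong-*ˡ d z {x} {y} x≡y = begin
    (z * x) % d              ≡⟨ %-distribˡ-* z x d ⟩
    ((z % d) * (x % d)) % d  ≡⟨ cong (λ t → ((z % d) * t) % d) x≡y ⟩
    ((z % d) * (y % d)) % d  ≡⟨ %-distribˡ-* z y d ⟨
    (z * y) % d              ∎

  %-cancel-+ʳ : ∀ d .{{_ : NonZero d}} v {x y} → (x + v) % d ≡ (y + v) % d → x % d ≡ y % d
  %-cancel-+ʳ d v {x} {y} x+v≡y+v = trans (sym (undo x)) (trans (%-cong-+ d x+v≡y+v refl) (undo y))
    where
    complement : ℕ
    complement = d ∸ v % d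
    v+complement : v + complement ≡ suc (v / d) * d
    v+complement = begin
      v + complement                   ≡⟨ cong (_+ complement) (trans (m≡m%n+[m/n]*n v d) (+-comm (v % d) _)) ⟩
      v / d * d + v % d + complement   ≡⟨ +-assoc (v / d * d) (v % d) complement ⟩
      v / d * d + (v % d + complement) ≡⟨ cong (v / d * d +_) (m+[n∸m]≡n (<⇒≤ (m%n<n v d))) ⟩
      v / d * d + d                    ≡⟨ +-comm (v / d * d) d ⟩
      suc (v / d) * d                  ∎
    undo : ∀ x → (x + v + complement) % d ≡ x % d
    undo x = trans (cong (_% d) (trans (+-assoc x v complement) (cong (x +_) v+complement)))
                   ([m+kn]%n≡m%n x (suc (v / d)) d)

  offset-injective : ∀ d .{{_ : NonZero d}} v {l l′} → l < d → l′ < d →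
    (l + v) % d % d ≡ (l′ + v) % d % d → l ≡ l′
  offset-injective d v {l} {l′} l<d l′<d eq = begin
    l        ≡⟨ m<n⇒m%n≡m l<d ⟨
    l % d    ≡⟨ %-cancel-+ʳ d v (trans (sym (m%n%n≡m%n (l + v) d)) (trans eq (m%n%n≡m%n (l′ + v) d))) ⟩
    l′ % d   ≡⟨ m<n⇒m%n≡m l′<d ⟩
    l′       ∎

  digit+d*t<d*e : ∀ d {a t e} → a < d → t < e → a + d * t < d * e
  digit+d*t<d*e d {a} {t} {e} a<d t<e =
    <-≤-trans (+-monoˡ-< (d * t) a<d) (subst (_≤ d * e) (*-suc d t) (*-monoʳ-≤ d t<e))

  [m+d*t]%d≡m%d : ∀ d .{{_ : NonZero d}} m t → (m + d * t) % d ≡ m % d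
  [m+d*t]%d≡m%d d m t = trans (cong (λ x → (m + x) % d) (*-comm d t)) ([m+kn]%n≡m%n m t d)

  divMod-unique : ∀ d .{{_ : NonZero d}} {a a′ t t′} → a < d → a′ < d → a + d * t ≡ a′ + d * t′ → a ≡ a′ × t ≡ t′
  divMod-unique d {a} {a′} {t} {t′} a<d a′<d eq =
    a≡a′ , *-cancelˡ-≡ t t′ d (+-cancelˡ-≡ a _ _ (trans eq (cong (_+ d * t′) (sym a≡a′))))
    where
    remainder : ∀ {a} t → a < d → (a + d * t) % d ≡ a
    remainder {a} t a<d = trans ([m+d*t]%d≡m%d d a t) (m<n⇒m%n≡m a<d)
    a≡a′ : a ≡ a′
    a≡a′ = trans (sym (remainder t a<d)) (trans (cong (_% d) eq) (remainder t′ a′<d))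

  module _ (n : ℕ) (φ : ℕ → ℕ) (cancel : ∀ u d → u < n → φ u ≡ φ (u + d) → φ d ≡ φ 0)
           (order : ∀ d → 0 < d → d < n → φ d ≢ φ 0) where

    private
      separated : ∀ {u v} → u < v → v < n → φ u ≢ φ v
      separated {u} {v} u<v v<n φu≡φv =
        order (v ∸ u) (m<n⇒0<n∸m u<v) (≤-<-trans (m∸n≤m v u) v<n)
              (cancel u (v ∸ u) (<-trans u<v v<n) (trans φu≡φv (cong φ (sym (m+[n∸m]≡n (<⇒≤ u<v))))))

    shift-cancel⇒injective : ∀ u v → u < n → v < n → φ u ≡ φ v → u ≡ v
    shift-cancel⇒injective u v u<n v<n φu≡φv with <-cmp u v
    ... | tri< u<v _ _ = ⊥-elim (separated u<v v<n φu≡φv)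
    ... | tri≈ _ u≡v _ = u≡v
    ... | tri> _ _ v<u = ⊥-elim (separated v<u u<n (sym φu≡φv))

  injective⇒surjective : ∀ n (h : ℕ → ℕ) → (∀ m → m < n → h m < n) →
    (∀ i j → i < n → j < n → h i ≡ h j → i ≡ j) → ∀ y → y < n → ∃ λ m → m < n × h m ≡ y
  -- A missed value y lets h, squeezed past y, inject Fin (1 + k) into Fin k.
  injective⇒surjective n h h<n injective y y<n with Fin.any? {n = n} (λ i → h (toℕ i) ≟ y)
  ... | yes (i , hi≡y) = toℕ i , Fin.toℕ<n i , hi≡y
  injective⇒surjective (suc k) h h<n injective y y<n | no missed =
    let i , j , i<j , squeezeᵢ≡squeezeⱼ = Fin.pigeonhole (n<1+n k) squeeze
    in ⊥-elim (Fin.<⇒≢ i<j (Fin.toℕ-injective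
         (injective _ _ (Fin.toℕ<n i) (Fin.toℕ<n j) (squeeze-injective squeezeᵢ≡squeezeⱼ))))
    where
    hᶠ : Fin (suc k) → Fin (suc k)
    hᶠ i = fromℕ< (h<n (toℕ i) (Fin.toℕ<n i))
    avoids : ∀ i → fromℕ< y<n ≢ hᶠ i
    avoids i eq = missed (i , trans (sym (Fin.toℕ-fromℕ< _)) (trans (cong toℕ (sym eq)) (Fin.toℕ-fromℕ< y<n)))
    squeeze : Fin (suc k) → Fin k
    squeeze i = punchOut (avoids i)
    squeeze-injective : ∀ {i j} → squeeze i ≡ squeeze j → h (toℕ i) ≡ h (toℕ j)
    squeeze-injective {i} {j} eq = trans (sym (Fin.toℕ-fromℕ< _))
      (trans (cong toℕ (Fin.punchOut-injective (avoids i) (avoids j) eq)) (Fin.toℕ-fromℕ< _))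

open Arithmetic

module PrimitiveRoot (p g : ℕ) .{{_ : NonZero p}} (p-prime : Prime p)
                     (g-primitive : IsPrimitiveRootModSq p g) where

  open import Data.Nat.Properties
  open ≡-Reasoning

  private instance
    p²≢0 : NonZero (p * p)
    p²≢0 = m*n≢0 p p

  ord : ℕ
  ord = p * (p ∸ 1)

  g^[_]%p : ℕ → ℕ
  g^[ m ]%p = g ^ m % p

  g^[_]%p² : ℕ → ℕ
  g^[ m ]%p² = g ^ m % (p * p)

  1<p : 1 < p
  1<p = nonTrivial⇒n>1 p {{prime⇒nonTrivial p-prime}}

  0<p : 0 < p
  0<p = <-trans z<s 1<p

  p-1≤ord : p ∸ 1 ≤ ord
  p-1≤ord = m≤n*m (p ∸ 1) p

  1%p≡1 : 1 % p ≡ 1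
  1%p≡1 = m<n⇒m%n≡m 1<p

  %p²%p : ∀ x → x % (p * p) % p ≡ x % p
  %p²%p x = m∣n⇒o%n%m≡o%m p (p * p) x (divides p refl)

  g^ord%p≡1 : g ^ ord % p ≡ 1 % p
  g^ord%p≡1 = trans (sym (%p²%p (g ^ ord))) (trans (cong (_% p) (proj₁ g-primitive)) (%p²%p 1))

  module _ (m : ℕ) .{{_ : NonZero m}} where

    g^-* : ∀ {a b} i j → a % m ≡ g ^ i % m → b % m ≡ g ^ j % m → (a * b) % m ≡ g ^ (i + j) % m
    g^-* {a} {b} i j a≡g^i b≡g^j = begin
      (a * b) % m                         ≡⟨ %-distribˡ-* a b m ⟩
      ((a % m) * (b % m)) % m             ≡⟨ cong₂ (λ x y → (x * y) % m) a≡g^i b≡g^j ⟩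
      ((g ^ i % m) * (g ^ j % m)) % m     ≡⟨ %-distribˡ-* (g ^ i) (g ^ j) m ⟨
      (g ^ i * g ^ j) % m                 ≡⟨ cong (_% m) (^-distribˡ-+-* g i j) ⟨
      g ^ (i + j) % m                     ∎

  module _ (m : ℕ) .{{_ : NonZero m}} (n : ℕ) (g^n≡1 : g ^ n % m ≡ 1 % m) where

    g^-periodic : ∀ x → g ^ (x + n) % m ≡ g ^ x % m
    g^-periodic x = begin
      g ^ (x + n) % m        ≡⟨ cong (_% m) (^-distribˡ-+-* g x n) ⟩
      (g ^ x * g ^ n) % m    ≡⟨ g^-* m x 0 refl g^n≡1 ⟩
      g ^ (x + 0) % m        ≡⟨ cong (λ k → g ^ k % m) (+-identityʳ x) ⟩
      g ^ x % m              ∎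

    g^-periodic-* : ∀ x c → g ^ (x + n * c) % m ≡ g ^ x % m
    g^-periodic-* x zero    = cong (λ k → g ^ k % m) (trans (cong (x +_) (*-zeroʳ n)) (+-identityʳ x))
    g^-periodic-* x (suc c) = begin
      g ^ (x + n * suc c) % m    ≡⟨ cong (λ k → g ^ k % m) (trans (cong (x +_) (*-suc n c)) (sym (+-assoc x n _))) ⟩
      g ^ (x + n + n * c) % m    ≡⟨ g^-periodic-* (x + n) c ⟩
      g ^ (x + n) % m            ≡⟨ g^-periodic x ⟩
      g ^ x % m                  ∎

    g^-cancel : ∀ u d → u ≤ n → g ^ u % m ≡ g ^ (u + d) % m → g ^ d % m ≡ 1 % m
    g^-cancel u d u≤n g^u≡g^[u+d] = begin
      g ^ d % m                           ≡⟨ g^-periodic d ⟨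
      g ^ (d + n) % m                     ≡⟨ cong (λ k → g ^ k % m) exponent ⟩
      g ^ (n ∸ u + (u + d)) % m           ≡⟨ cong (_% m) (^-distribˡ-+-* g (n ∸ u) (u + d)) ⟩
      (g ^ (n ∸ u) * g ^ (u + d)) % m     ≡⟨ %-cong-*ˡ m (g ^ (n ∸ u)) g^u≡g^[u+d] ⟨
      (g ^ (n ∸ u) * g ^ u) % m           ≡⟨ cong (_% m) (^-distribˡ-+-* g (n ∸ u) u) ⟨
      g ^ (n ∸ u + u) % m                 ≡⟨ cong (λ k → g ^ k % m) (m∸n+n≡m u≤n) ⟩
      g ^ n % m                           ≡⟨ g^n≡1 ⟩
      1 % m                               ∎
      where
      exponent : d + n ≡ n ∸ u + (u + d)
      exponent = begin
        d + n              ≡⟨ +-comm d n ⟩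
        n + d              ≡⟨ cong (_+ d) (m∸n+n≡m u≤n) ⟨
        n ∸ u + u + d      ≡⟨ +-assoc (n ∸ u) u d ⟩
        n ∸ u + (u + d)    ∎

  g^%p²-periodic : ∀ x → g^[ x + ord ]%p² ≡ g^[ x ]%p²
  g^%p²-periodic = g^-periodic (p * p) ord (proj₁ g-primitive)

  g^%p²-injective : ∀ u v → u < ord → v < ord → g^[ u ]%p² ≡ g^[ v ]%p² → u ≡ v
  g^%p²-injective = shift-cancel⇒injective ord g^[_]%p²
    (λ u d u<ord → g^-cancel (p * p) ord (proj₁ g-primitive) u d (<⇒≤ u<ord))
    (proj₂ g-primitive)

  binomial-lift : ∀ q m → (1 + q * p) ^ m % (p * p) ≡ (1 + m * q * p) % (p * p)
  binomial-lift q zero    = refl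
  binomial-lift q (suc m) = begin
    ((1 + q * p) * (1 + q * p) ^ m) % (p * p)            ≡⟨ %-cong-*ˡ (p * p) (1 + q * p) (binomial-lift q m) ⟩
    ((1 + q * p) * (1 + m * q * p)) % (p * p)            ≡⟨ cong (_% (p * p)) (expand q p m) ⟩
    (1 + suc m * q * p + m * q * q * (p * p)) % (p * p)  ≡⟨ [m+kn]%n≡m%n (1 + suc m * q * p) (m * q * q) (p * p) ⟩
    (1 + suc m * q * p) % (p * p)                        ∎
    where
    expand : ∀ q p m → (1 + q * p) * (1 + m * q * p) ≡ 1 + suc m * q * p + m * q * q * (p * p)
    expand = solve-∀

  -- By binomial-lift, g^d ≡ 1 (mod p) would give g^(dp) ≡ 1 (mod p²).
  g^%p≢1 : ∀ d → 0 < d → d < p ∸ 1 → g^[ d ]%p ≢ 1 % p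
  g^%p≢1 d 0<d d<p-1 g^d≡1 = proj₂ g-primitive (d * p) 0<dp dp<ord g^dp≡1
    where
    q = g ^ d / p
    g^d≡1+qp : g ^ d ≡ 1 + q * p
    g^d≡1+qp = trans (m≡m%n+[m/n]*n (g ^ d) p) (cong (_+ q * p) (trans g^d≡1 1%p≡1))
    0<dp : 0 < d * p
    0<dp = *-mono-< {0} {d} {0} {p} 0<d 0<p
    dp<ord : d * p < ord
    dp<ord = subst (d * p <_) (*-comm (p ∸ 1) p) (*-monoˡ-< p d<p-1)
    g^dp≡1 : g ^ (d * p) % (p * p) ≡ 1 % (p * p)
    g^dp≡1 = begin
      g ^ (d * p) % (p * p)          ≡⟨ cong (_% (p * p)) (^-*-assoc g d p) ⟨
      (g ^ d) ^ p % (p * p)          ≡⟨ cong (λ x → x ^ p % (p * p)) g^d≡1+qp ⟩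
      (1 + q * p) ^ p % (p * p)      ≡⟨ binomial-lift q p ⟩
      (1 + p * q * p) % (p * p)      ≡⟨ cong (λ x → (1 + x) % (p * p)) (regroup p q) ⟩
      (1 + q * (p * p)) % (p * p)    ≡⟨ [m+kn]%n≡m%n 1 q (p * p) ⟩
      1 % (p * p)                    ∎
      where
      regroup : ∀ p q → p * q * p ≡ q * (p * p)
      regroup = solve-∀

  g^%p-injective : ∀ u v → u < p ∸ 1 → v < p ∸ 1 → g^[ u ]%p ≡ g^[ v ]%p → u ≡ v
  g^%p-injective = shift-cancel⇒injective (p ∸ 1) g^[_]%p
    (λ u d u<p-1 → g^-cancel p ord g^ord%p≡1 u d (≤-trans (<⇒≤ u<p-1) p-1≤ord))
    g^%p≢1

  p∤g^ : ∀ m → ¬ p ∣ g ^ m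
  p∤g^ zero    p∣1 = <-irrefl refl (<-≤-trans 1<p (∣⇒≤ p∣1))
  p∤g^ (suc m) p∣g^[1+m] with euclidsLemma g (g ^ m) p-prime p∣g^[1+m]
  ... | inj₂ p∣g^m = p∤g^ m p∣g^m
  ... | inj₁ p∣g   = 0≢1+n (begin
    0                 ≡⟨ n∣m⇒m%n≡0 (g ^ ord) p (p∣g^ord ord 0<ord) ⟨
    g ^ ord % p       ≡⟨ g^ord%p≡1 ⟩
    1 % p             ≡⟨ 1%p≡1 ⟩
    1                 ∎)
    where
    p∣g^ord : ∀ k → 0 < k → p ∣ g ^ k
    p∣g^ord (suc k) _ = ∣m⇒∣m*n (g ^ k) p∣g
    0<ord : 0 < ord
    0<ord = *-mono-< {0} {p} {0} {p ∸ 1} 0<p (m<n⇒0<n∸m 1<p)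

  g^%p≢0 : ∀ m → g^[ m ]%p ≢ 0
  g^%p≢0 m g^m%p≡0 = p∤g^ m (m%n≡0⇒n∣m (g ^ m) p g^m%p≡0)

  1≤g^%p : ∀ m → 1 ≤ g^[ m ]%p
  1≤g^%p m = n≢0⇒n>0 (g^%p≢0 m)

  g^%p∸1<p-1 : ∀ m → g^[ m ]%p ∸ 1 < p ∸ 1
  g^%p∸1<p-1 m = ∸-monoˡ-< (m%n<n (g ^ m) p) (1≤g^%p m)

  g^%p∸1-injective : ∀ u v → u < p ∸ 1 → v < p ∸ 1 → g^[ u ]%p ∸ 1 ≡ g^[ v ]%p ∸ 1 → u ≡ v
  g^%p∸1-injective u v u<p-1 v<p-1 eq = g^%p-injective u v u<p-1 v<p-1
    (trans (sym (m∸n+n≡m (1≤g^%p u))) (trans (cong (_+ 1) eq) (m∸n+n≡m (1≤g^%p v))))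

  g^%p-surjective : ∀ y → 0 < y → y < p → ∃ λ m → m < p ∸ 1 × g^[ m ]%p ≡ y
  g^%p-surjective y 0<y y<p =
    let m , m<p-1 , eq = injective⇒surjective (p ∸ 1) (λ m → g^[ m ]%p ∸ 1) (λ m _ → g^%p∸1<p-1 m)
                                             g^%p∸1-injective (y ∸ 1) (∸-monoˡ-< y<p 0<y)
    in m , m<p-1 , trans (sym (m∸n+n≡m (1≤g^%p m))) (trans (cong (_+ 1) eq) (m∸n+n≡m 0<y))

  fermat : g^[ p ∸ 1 ]%p ≡ 1 % p
  fermat = fromPreimage (g^%p-surjective g^[ p ∸ 1 ]%p (n≢0⇒n>0 (g^%p≢0 (p ∸ 1))) (m%n<n (g ^ (p ∸ 1)) p))
    where
    fromPreimage : (∃ λ m → m < p ∸ 1 × g^[ m ]%p ≡ g^[ p ∸ 1 ]%p) → g^[ p ∸ 1 ]%p ≡ 1 % p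
    fromPreimage (zero  , _     , g^0≡g^[p-1]) = sym g^0≡g^[p-1]
    fromPreimage (suc m , m<p-1 , g^m≡g^[p-1]) =
      ⊥-elim (g^%p≢1 (p ∸ 1 ∸ suc m) (m<n⇒0<n∸m m<p-1) (∸-monoʳ-< z<s (<⇒≤ m<p-1))
        (g^-cancel p ord g^ord%p≡1 (suc m) (p ∸ 1 ∸ suc m) (≤-trans (<⇒≤ m<p-1) p-1≤ord)
          (trans g^m≡g^[p-1] (cong g^[_]%p (sym (m+[n∸m]≡n (<⇒≤ m<p-1)))))))

  g^%p-periodic : ∀ x → g^[ x + (p ∸ 1) ]%p ≡ g^[ x ]%p
  g^%p-periodic = g^-periodic p (p ∸ 1) fermat

  g^%p-periodic-* : ∀ x c → g^[ x + (p ∸ 1) * c ]%p ≡ g^[ x ]%p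
  g^%p-periodic-* = g^-periodic-* p (p ∸ 1) fermat

  g^%p²%p : ∀ m → g^[ m ]%p² % p ≡ g^[ m ]%p
  g^%p²%p m = %p²%p (g ^ m)

  p*-%p² : ∀ z → (p * z) % (p * p) ≡ p * (z % p)
  p*-%p² z = begin
    (p * z) % (p * p)    ≡⟨ cong (_% (p * p)) (*-comm p z) ⟩
    (z * p) % (p * p)    ≡⟨ m%n*o≡m*o%[n*o] z p p ⟨
    z % p * p            ≡⟨ *-comm (z % p) p ⟩
    p * (z % p)          ∎

  g^%p²-*-g^%p² : ∀ m n → (g^[ m ]%p² * g^[ n ]%p²) % (p * p) ≡ g^[ m + n ]%p²
  g^%p²-*-g^%p² m n = g^-* (p * p) m n (m%n%n≡m%n (g ^ m) (p * p)) (m%n%n≡m%n (g ^ n) (p * p))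

  g^%p²-*-p*g^%p : ∀ m n → (g^[ m ]%p² * (p * g^[ n ]%p)) % (p * p) ≡ p * g^[ m + n ]%p
  g^%p²-*-p*g^%p m n = begin
    (g^[ m ]%p² * (p * g^[ n ]%p)) % (p * p)    ≡⟨ cong (_% (p * p)) (x*[p*y]≡p*[x*y] g^[ m ]%p² p g^[ n ]%p) ⟩
    (p * (g^[ m ]%p² * g^[ n ]%p)) % (p * p)    ≡⟨ p*-%p² _ ⟩
    p * ((g^[ m ]%p² * g^[ n ]%p) % p)          ≡⟨ cong (p *_) (g^-* p m n (g^%p²%p m) (m%n%n≡m%n (g ^ n) p)) ⟩
    p * g^[ m + n ]%p                           ∎
    where
    x*[p*y]≡p*[x*y] : ∀ x p y → x * (p * y) ≡ p * (x * y)
    x*[p*y]≡p*[x*y] = solve-∀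

  p*g^%p-*-g^%p² : ∀ m n → (p * g^[ m ]%p * g^[ n ]%p²) % (p * p) ≡ p * g^[ m + n ]%p
  p*g^%p-*-g^%p² m n = begin
    (p * g^[ m ]%p * g^[ n ]%p²) % (p * p)      ≡⟨ cong (_% (p * p)) (*-assoc p g^[ m ]%p g^[ n ]%p²) ⟩
    (p * (g^[ m ]%p * g^[ n ]%p²)) % (p * p)    ≡⟨ p*-%p² _ ⟩
    p * ((g^[ m ]%p * g^[ n ]%p²) % p)          ≡⟨ cong (p *_) (g^-* p m n (m%n%n≡m%n (g ^ m) p) (g^%p²%p n)) ⟩
    p * g^[ m + n ]%p                           ∎

module RangeSum {c ℓ : Level} (R : CommutativeRing c ℓ) where

  open CommutativeRing R
    renaming (_+_ to _+ᴿ_; _*_ to _*ᴿ_; _-_ to _-ᴿ_; refl to ≈-refl; sym to ≈-sym; trans to ≈-trans)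
  open import Algebra.Properties.Ring ring using (+-cancelˡ; +-cancelʳ; x[y-z]≈xy-xz)
  open import Algebra.Properties.CommutativeSemigroup +-commutativeSemigroup using (interchange)
  open import Algebra.Properties.Semiring.Exp semiring using () renaming (_^_ to _^ᴿ_)
  open import Relation.Binary.Reasoning.Setoid setoid

  ∑ : ℕ → (ℕ → Carrier) → Carrier
  ∑ zero    F = 0#
  ∑ (suc n) F = F 0 +ᴿ ∑ n (F ∘ suc)

  syntax ∑ n (λ i → x) = ∑[ i < n ] x

  foldr-applyUpTo : ∀ n (h : ℕ → ℕ) (F : ℕ → Carrier) →
    foldr (λ i acc → F i +ᴿ acc) 0# (applyUpTo h n) ≡ ∑ n (F ∘ h)
  foldr-applyUpTo zero    h F = refl
  foldr-applyUpTo (suc n) h F = cong (F (h 0) +ᴿ_) (foldr-applyUpTo n (h ∘ suc) F)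

  ∑-cong : ∀ n {F G : ℕ → Carrier} → (∀ i → i < n → F i ≈ G i) → ∑ n F ≈ ∑ n G
  ∑-cong zero    eq = ≈-refl
  ∑-cong (suc n) eq = +-cong (eq 0 z<s) (∑-cong n (λ i i<n → eq (suc i) (s<s i<n)))

  ∑-zero : ∀ n → ∑[ i < n ] 0# ≈ 0#
  ∑-zero zero    = ≈-refl
  ∑-zero (suc n) = ≈-trans (+-identityˡ _) (∑-zero n)

  ∑-distrib-+ : ∀ n (F G : ℕ → Carrier) → ∑[ i < n ] (F i +ᴿ G i) ≈ ∑ n F +ᴿ ∑ n G
  ∑-distrib-+ zero    F G = ≈-sym (+-identityˡ 0#)
  ∑-distrib-+ (suc n) F G =
    ≈-trans (+-congˡ (∑-distrib-+ n (F ∘ suc) (G ∘ suc))) (interchange (F 0) (G 0) _ _)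

  ∑-split : ∀ m n (F : ℕ → Carrier) → ∑ (m + n) F ≈ ∑ m F +ᴿ ∑[ i < n ] F (m + i)
  ∑-split zero    n F = ≈-sym (+-identityˡ _)
  ∑-split (suc m) n F = ≈-trans (+-congˡ (∑-split m n (F ∘ suc))) (≈-sym (+-assoc _ _ _))

  ∑-last : ∀ n (F : ℕ → Carrier) → ∑ (suc n) F ≈ ∑ n F +ᴿ F n
  ∑-last n F = begin
    ∑ (suc n) F                  ≡⟨ cong (λ k → ∑ k F) (ℕ.+-comm 1 n) ⟩
    ∑ (n + 1) F                  ≈⟨ ∑-split n 1 F ⟩
    ∑ n F +ᴿ (F (n + 0) +ᴿ 0#)   ≈⟨ +-congˡ (+-identityʳ _) ⟩
    ∑ n F +ᴿ F (n + 0)           ≡⟨ cong (λ k → ∑ n F +ᴿ F k) (ℕ.+-identityʳ n) ⟩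
    ∑ n F +ᴿ F n                 ∎

  ∑-swap : ∀ m n (H : ℕ → ℕ → Carrier) →
    ∑[ i < m ] ∑[ j < n ] H i j ≈ ∑[ j < n ] ∑[ i < m ] H i j
  ∑-swap zero    n H = ≈-sym (∑-zero n)
  ∑-swap (suc m) n H =
    ≈-trans (+-congˡ (∑-swap m n (H ∘ suc))) (≈-sym (∑-distrib-+ n (H 0) _))

  ∑-blocks : ∀ e f (H : ℕ → Carrier) → ∑ (e * f) H ≈ ∑[ t < e ] ∑[ l < f ] H (f * t + l)
  ∑-blocks zero    f H = ≈-refl
  ∑-blocks (suc e) f H = begin
    ∑ (f + e * f) H                                          ≈⟨ ∑-split f (e * f) H ⟩
    ∑ f H +ᴿ ∑[ i < e * f ] H (f + i)                        ≈⟨ +-cong (∑-cong f λ l _ → reflexive (cong H (firstBlock l)))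
                                                                       (∑-blocks e f (λ i → H (f + i))) ⟩
    ∑[ l < f ] H (f * 0 + l) +ᴿ ∑[ t < e ] ∑[ l < f ] H (f + (f * t + l))
                                                             ≈⟨ +-congˡ (∑-cong e λ t _ → ∑-cong f λ l _ →
                                                                           reflexive (cong H (nextBlock t l))) ⟩
    ∑[ l < f ] H (f * 0 + l) +ᴿ ∑[ t < e ] ∑[ l < f ] H (f * suc t + l) ∎
    where
    firstBlock : ∀ l → l ≡ f * 0 + l
    firstBlock l = cong (_+ l) (sym (ℕ.*-zeroʳ f))
    nextBlock : ∀ t l → f + (f * t + l) ≡ f * suc t + l
    nextBlock t l = trans (sym (ℕ.+-assoc f (f * t) l)) (cong (_+ l) (sym (ℕ.*-suc f t)))

  ∑-rotate : ∀ n (H : ℕ → Carrier) → H n ≈ H 0 → ∑[ t < n ] H (suc t) ≈ ∑ n H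
  ∑-rotate n H Hn≈H0 = +-cancelʳ (H 0) _ _ (begin
    ∑[ t < n ] H (suc t) +ᴿ H 0  ≈⟨ +-comm _ (H 0) ⟩
    ∑ (suc n) H                  ≈⟨ ∑-last n H ⟩
    ∑ n H +ᴿ H n                 ≈⟨ +-congˡ Hn≈H0 ⟩
    ∑ n H +ᴿ H 0                 ∎)

  ∑-shift-periodic : ∀ n v (H : ℕ → Carrier) → (∀ x → H (x + n) ≈ H x) →
    ∑[ t < n ] H (v + t) ≈ ∑ n H
  ∑-shift-periodic n zero    H periodic = ≈-refl
  ∑-shift-periodic n (suc v) H periodic =
    ≈-trans (∑-shift-periodic n v (H ∘ suc) (periodic ∘ suc)) (∑-rotate n H (periodic 0))

  ∑-progression-mod : ∀ d .{{_ : NonZero d}} e (Φ : ℕ → Carrier) → (∀ x → Φ (x + d * e) ≈ Φ x) →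
    ∀ w → ∑[ t < e ] Φ (w + d * t) ≈ ∑[ t < e ] Φ (w % d + d * t)
  ∑-progression-mod d e Φ periodic w =
    ≈-trans (∑-cong e λ t _ → reflexive (cong Φ (divide t))) (∑-shift-periodic e (w / d) H periodicH)
    where
    H : ℕ → Carrier
    H t = Φ (w % d + d * t)
    periodicH : ∀ x → H (x + e) ≈ H x
    periodicH x = ≈-trans (reflexive (cong Φ (trans (cong (w % d +_) (ℕ.*-distribˡ-+ d x e))
                                                  (sym (ℕ.+-assoc (w % d) (d * x) (d * e))))))
                        (periodic _)
    divide : ∀ t → w + d * t ≡ w % d + d * (w / d + t)
    divide t = trans (cong (_+ d * t) (m≡m%n+[m/n]*n w d)) (regroup (w % d) (w / d) d t)
      where
      regroup : ∀ a q d t → a + q * d + d * t ≡ a + d * (q + t)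
      regroup = solve-∀

  *-distribˡ-∑ : ∀ n x (F : ℕ → Carrier) → x *ᴿ ∑ n F ≈ ∑[ i < n ] (x *ᴿ F i)
  *-distribˡ-∑ zero    x F = zeroʳ x
  *-distribˡ-∑ (suc n) x F = ≈-trans (distribˡ x _ _) (+-congˡ (*-distribˡ-∑ n x (F ∘ suc)))

  ∑-progression-cong : ∀ d .{{_ : NonZero d}} e (Φ : ℕ → Carrier) → (∀ x → Φ (x + d * e) ≈ Φ x) →
    ∀ {w w′} → w % d ≡ w′ % d → ∑[ t < e ] Φ (w + d * t) ≈ ∑[ t < e ] Φ (w′ + d * t)
  ∑-progression-cong d e Φ periodic {w} {w′} w≡w′ = begin
    ∑[ t < e ] Φ (w + d * t)        ≈⟨ ∑-progression-mod d e Φ periodic w ⟩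
    ∑[ t < e ] Φ (w % d + d * t)    ≡⟨ cong (λ u → ∑[ t < e ] Φ (u + d * t)) w≡w′ ⟩
    ∑[ t < e ] Φ (w′ % d + d * t)   ≈⟨ ∑-progression-mod d e Φ periodic w′ ⟨
    ∑[ t < e ] Φ (w′ + d * t)       ∎

  ∑∈ : ℕ → (ℕ → Bool) → (ℕ → Carrier) → Carrier
  ∑∈ n S F = ∑[ i < n ] (if S i then F i else 0#)

  ∑∈-cong : ∀ n {S S′ : ℕ → Bool} (F : ℕ → Carrier) → (∀ i → i < n → S i ≡ S′ i) → ∑∈ n S F ≈ ∑∈ n S′ F
  ∑∈-cong n F eq = ∑-cong n λ i i<n → reflexive (cong (λ b → if b then F i else 0#) (eq i i<n))

  ∑∈-∨ : ∀ n (A B : ℕ → Bool) (F : ℕ → Carrier) → (∀ i → i < n → T (A i) → T (B i) → ⊥) →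
    ∑∈ n (λ i → A i ∨ B i) F ≈ ∑∈ n A F +ᴿ ∑∈ n B F
  ∑∈-∨ n A B F disjoint = ≈-trans (∑-cong n split) (∑-distrib-+ n _ _)
    where
    split : ∀ i → i < n → (if A i ∨ B i then F i else 0#) ≈ (if A i then F i else 0#) +ᴿ (if B i then F i else 0#)
    split i i<n with A i | B i | disjoint i i<n
    ... | true  | true  | both = ⊥-elim (both tt tt)
    ... | true  | false | _    = ≈-sym (+-identityʳ _)
    ... | false | _     | _    = ≈-sym (+-identityˡ _)

  ∑∈-singleton : ∀ n c (F : ℕ → Carrier) → c < n → ∑∈ n (c ≡ᵇ_) F ≈ F c
  ∑∈-singleton (suc n) zero    F _         = ≈-trans (+-congˡ (∑-zero n)) (+-identityʳ _)
  ∑∈-singleton (suc n) (suc c) F (s<s c<n) = ≈-trans (+-identityˡ _) (∑∈-singleton n c (F ∘ suc) c<n)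

  ∑∈-⋃ : ∀ n m (Q : ℕ → ℕ → Bool) (F : ℕ → Carrier) →
    (∀ l l′ i → l < m → l′ < m → i < n → T (Q l i) → T (Q l′ i) → l ≡ l′) →
    ∑∈ n (λ i → anyBelow m (λ l → Q l i)) F ≈ ∑[ l < m ] ∑∈ n (Q l) F
  ∑∈-⋃ n zero    Q F disjoint = ∑-zero n
  ∑∈-⋃ n (suc m) Q F disjoint =
    ≈-trans (∑∈-∨ n _ _ F first-disjoint) (+-congˡ (∑∈-⋃ n m (Q ∘ suc) F rest-disjoint))
    where
    first-disjoint : ∀ i → i < n → T (Q 0 i) → T (anyBelow m (λ l → Q (suc l) i)) → ⊥
    first-disjoint i i<n q₀ qs with anyBelow⇒∃ m _ qs
    ... | l , l<m , qₗ with () ← disjoint 0 (suc l) i z<s (s<s l<m) i<n q₀ qₗ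
    rest-disjoint : ∀ l l′ i → l < m → l′ < m → i < n → T (Q (suc l) i) → T (Q (suc l′) i) → l ≡ l′
    rest-disjoint l l′ i l<m l′<m i<n q q′ = ℕ.suc-injective (disjoint _ _ i (s<s l<m) (s<s l′<m) i<n q q′)

  ∑∈-image : ∀ n e (h : ℕ → ℕ) (F : ℕ → Carrier) → (∀ t → t < e → h t < n) →
    (∀ t u → t < e → u < e → h t ≡ h u → t ≡ u) →
    ∑∈ n (λ i → anyBelow e (λ t → h t ≡ᵇ i)) F ≈ ∑[ t < e ] F (h t)
  ∑∈-image n e h F h<n injective =
    ≈-trans (∑∈-⋃ n e (λ t i → h t ≡ᵇ i) F disjoint)
            (∑-cong e λ t t<e → ∑∈-singleton n (h t) F (h<n t t<e))
    where
    disjoint : ∀ t u i → t < e → u < e → i < n → T (h t ≡ᵇ i) → T (h u ≡ᵇ i) → t ≡ u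
    disjoint t u i t<e u<e _ ht≡i hu≡i = injective t u t<e u<e (trans (ℕ.≡ᵇ⇒≡ _ _ ht≡i) (sym (ℕ.≡ᵇ⇒≡ _ _ hu≡i)))

  ∑∈-⋃-images : ∀ n m e (h : ℕ → ℕ → ℕ) (F : ℕ → Carrier) → (∀ l t → l < m → t < e → h l t < n) →
    (∀ l l′ t t′ → l < m → l′ < m → t < e → t′ < e → h l t ≡ h l′ t′ → l ≡ l′ × t ≡ t′) →
    ∑∈ n (λ i → anyBelow m (λ l → anyBelow e (λ t → h l t ≡ᵇ i))) F ≈ ∑[ l < m ] ∑[ t < e ] F (h l t)
  ∑∈-⋃-images n m e h F h<n injective =
    ≈-trans (∑∈-⋃ n m _ F disjoint)
            (∑-cong m λ l l<m → ∑∈-image n e (h l) F (λ t → h<n l t l<m)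
                                   (λ t t′ t<e t′<e eq → proj₂ (injective l l t t′ l<m l<m t<e t′<e eq)))
    where
    disjoint : ∀ l l′ i → l < m → l′ < m → i < n →
      T (anyBelow e (λ t → h l t ≡ᵇ i)) → T (anyBelow e (λ t → h l′ t ≡ᵇ i)) → l ≡ l′
    disjoint l l′ i l<m l′<m _ q q′ =
      let t  , t<e  , hₗₜ≡i   = anyBelow⇒∃ e _ q
          t′ , t′<e , hₗ′ₜ′≡i = anyBelow⇒∃ e _ q′
      in proj₁ (injective l l′ t t′ l<m l′<m t<e t′<e (trans (ℕ.≡ᵇ⇒≡ _ _ hₗₜ≡i) (sym (ℕ.≡ᵇ⇒≡ _ _ hₗ′ₜ′≡i))))

  ∑-permute : ∀ n (h : ℕ → ℕ) (F : ℕ → Carrier) → (∀ m → m < n → h m < n) →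
    (∀ i j → i < n → j < n → h i ≡ h j → i ≡ j) → ∑[ i < n ] F (h i) ≈ ∑ n F
  ∑-permute n h F h<n injective =
    ≈-trans (≈-sym (∑∈-image n n h F h<n injective)) (∑∈-cong n F λ i i<n → T-injective (λ _ → tt) (λ _ → hit i i<n))
    where
    hit : ∀ i → i < n → T (anyBelow n (λ t → h t ≡ᵇ i))
    hit i i<n = let m , m<n , hm≡i = injective⇒surjective n h h<n injective i i<n
                in ∃⇒anyBelow n _ m<n (ℕ.≡⇒≡ᵇ _ _ hm≡i)

  ∑-geometric : ∀ n ζ → ζ ^ᴿ n ≈ 1# → (∃ λ y → (ζ -ᴿ 1#) *ᴿ y ≈ 1#) → ∑[ i < n ] (ζ ^ᴿ i) ≈ 0#
  ∑-geometric n ζ ζⁿ≈1 (y , [ζ-1]y≈1) = begin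
    G                          ≈⟨ *-identityʳ G ⟨
    G *ᴿ 1#                    ≈⟨ *-congˡ [ζ-1]y≈1 ⟨
    G *ᴿ ((ζ -ᴿ 1#) *ᴿ y)      ≈⟨ *-assoc G _ y ⟨
    (G *ᴿ (ζ -ᴿ 1#)) *ᴿ y      ≈⟨ *-congʳ G[ζ-1]≈0 ⟩
    0# *ᴿ y                    ≈⟨ zeroˡ y ⟩
    0#                         ∎
    where
    G : Carrier
    G = ∑[ i < n ] (ζ ^ᴿ i)
    ζG≈G : ζ *ᴿ G ≈ G
    ζG≈G = +-cancelˡ 1# _ _ (begin
      1# +ᴿ ζ *ᴿ G                    ≈⟨ +-congˡ (*-distribˡ-∑ n ζ (ζ ^ᴿ_)) ⟩
      ∑ (suc n) (ζ ^ᴿ_)               ≈⟨ ∑-last n (ζ ^ᴿ_) ⟩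
      G +ᴿ ζ ^ᴿ n                     ≈⟨ +-congˡ ζⁿ≈1 ⟩
      G +ᴿ 1#                         ≈⟨ +-comm G 1# ⟩
      1# +ᴿ G                         ∎)
    G[ζ-1]≈0 : G *ᴿ (ζ -ᴿ 1#) ≈ 0#
    G[ζ-1]≈0 = begin
      G *ᴿ (ζ -ᴿ 1#)            ≈⟨ x[y-z]≈xy-xz G ζ 1# ⟩
      G *ᴿ ζ -ᴿ G *ᴿ 1#         ≈⟨ +-cong (≈-trans (*-comm G ζ) ζG≈G) (-‿cong (*-identityʳ G)) ⟩
      G -ᴿ G                    ≈⟨ -‿inverseʳ G ⟩
      0#                        ∎

  module CharacteristicTwo (1+1≈0 : 1# +ᴿ 1# ≈ 0#) where

    x+x≈0 : ∀ x → x +ᴿ x ≈ 0#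
    x+x≈0 x = begin
      x +ᴿ x                  ≈⟨ +-cong (*-identityˡ x) (*-identityˡ x) ⟨
      1# *ᴿ x +ᴿ 1# *ᴿ x      ≈⟨ distribʳ x 1# 1# ⟨
      (1# +ᴿ 1#) *ᴿ x         ≈⟨ *-congʳ 1+1≈0 ⟩
      0# *ᴿ x                 ≈⟨ zeroˡ x ⟩
      0#                      ∎

    1+x≈0⇒x≈1 : ∀ x → 1# +ᴿ x ≈ 0# → x ≈ 1#
    1+x≈0⇒x≈1 x 1+x≈0 = +-cancelˡ 1# x 1# (≈-trans 1+x≈0 (≈-sym 1+1≈0))

    x+[y+x]≈y : ∀ x y → x +ᴿ (y +ᴿ x) ≈ y
    x+[y+x]≈y x y = begin
      x +ᴿ (y +ᴿ x)       ≈⟨ +-congˡ (+-comm y x) ⟩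
      x +ᴿ (x +ᴿ y)       ≈⟨ +-assoc x x y ⟨
      (x +ᴿ x) +ᴿ y       ≈⟨ +-congʳ (x+x≈0 x) ⟩
      0# +ᴿ y             ≈⟨ +-identityˡ y ⟩
      y                   ∎

    ∑-double : ∀ n x → ∑[ i < n + n ] x ≈ 0#
    ∑-double n x = begin
      ∑[ i < n + n ] x                    ≈⟨ ∑-split n n (λ _ → x) ⟩
      ∑[ i < n ] x +ᴿ ∑[ i < n ] x        ≈⟨ x+x≈0 _ ⟩
      0#                                  ∎

module Cyclotomy (p e f g : ℕ) .{{_ : NonZero p}} .{{_ : NonZero f}} (p-prime : Prime p)
                 (p-1≡ef : p ∸ 1 ≡ e * f) (2∣f : 2 ∣ f) (g-primitive : IsPrimitiveRootModSq p g) where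

  open Setup p e f g
  open PrimitiveRoot p g p-prime g-primitive

  -- As in memD: D_j^(p) = { g^(ι₁ j t) mod p | t < e } and D_j^(p²) = { g^(ι₂ j t) mod p² | t < e }.
  ι₁ : ℕ → ℕ → ℕ
  ι₁ j t = j % f + f * t

  ι₂ : ℕ → ℕ → ℕ
  ι₂ j t = j % (p * f) + p * f * t

  pD₁-at : ℕ → ℕ → ℕ
  pD₁-at j t = p * g^[ ι₁ j t ]%p

  D₂-at : ℕ → ℕ → ℕ
  D₂-at j t = g^[ ι₂ j t ]%p²

  ord≡pf*e : ord ≡ p * f * e
  ord≡pf*e = trans (cong (p *_) p-1≡ef) (regroup p e f)
    where
    regroup : ∀ p e f → p * (e * f) ≡ p * f * e
    regroup = solve-∀

  ι₁<p-1 : ∀ j {t} → t < e → ι₁ j t < p ∸ 1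
  ι₁<p-1 j {t} t<e = subst (ι₁ j t <_) (trans (ℕ.*-comm f e) (sym p-1≡ef)) (digit+d*t<d*e f (m%n<n j f) t<e)

  ι₂<ord : ∀ j {t} → t < e → ι₂ j t < ord
  ι₂<ord j {t} t<e = subst (ι₂ j t <_) (sym ord≡pf*e) (digit+d*t<d*e (p * f) (m%n<n j (p * f)) t<e)

  pD₁-at<p² : ∀ j t → pD₁-at j t < p * p
  pD₁-at<p² j t = ℕ.*-monoʳ-< p (m%n<n (g ^ ι₁ j t) p)

  D₂-at<p² : ∀ j t → D₂-at j t < p * p
  D₂-at<p² j t = m%n<n (g ^ ι₂ j t) (p * p)

  pD₁-at-injective : ∀ v l l′ t t′ → l < f / 2 → l′ < f / 2 → t < e → t′ < e →
    pD₁-at ((l + v) % f) t ≡ pD₁-at ((l′ + v) % f) t′ → l ≡ l′ × t ≡ t′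
  pD₁-at-injective v l l′ t t′ l<f/2 l′<f/2 t<e t′<e eq =
    let same-class , t≡t′ = divMod-unique f (m%n<n _ f) (m%n<n _ f)
          (g^%p-injective _ _ (ι₁<p-1 _ t<e) (ι₁<p-1 _ t′<e) (ℕ.*-cancelˡ-≡ _ _ p eq))
    in offset-injective f v (below-f l<f/2) (below-f l′<f/2) same-class , t≡t′
    where
    below-f : ∀ {l} → l < f / 2 → l < f
    below-f l<f/2 = ℕ.<-≤-trans l<f/2 (m/n≤m f 2)

  D₂-at-injective : ∀ v l l′ t t′ → l < p * f / 2 → l′ < p * f / 2 → t < e → t′ < e →
    D₂-at ((l + v) % (p * f)) t ≡ D₂-at ((l′ + v) % (p * f)) t′ → l ≡ l′ × t ≡ t′
  D₂-at-injective v l l′ t t′ l<pf/2 l′<pf/2 t<e t′<e eq =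
    let same-class , t≡t′ = divMod-unique (p * f) (m%n<n _ (p * f)) (m%n<n _ (p * f))
          (g^%p²-injective _ _ (ι₂<ord _ t<e) (ι₂<ord _ t′<e) eq)
    in offset-injective (p * f) v (below-pf l<pf/2) (below-pf l′<pf/2) same-class , t≡t′
    where
    below-pf : ∀ {l} → l < p * f / 2 → l < p * f
    below-pf l<pf/2 = ℕ.<-≤-trans l<pf/2 (m/n≤m (p * f) 2)

  D₂≡image : ∀ j a → D₂ j a ≡ anyBelow e (λ t → D₂-at j t ≡ᵇ a)
  D₂≡image j a = any-applyUpTo e id _

  pD₁≡image : ∀ j a → pD₁ j a ≡ anyBelow e (λ t → pD₁-at j t ≡ᵇ a)
  pD₁≡image j a = T-injective to from
    where
    g^ι₁∈D₁ : ∀ {t} → t < e → T (D₁ j g^[ ι₁ j t ]%p)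
    g^ι₁∈D₁ {t} t<e = subst T (sym (any-applyUpTo e id _)) (∃⇒anyBelow e _ t<e (ℕ.≡⇒≡ᵇ g^[ ι₁ j t ]%p _ refl))
    to : T (pD₁ j a) → T (anyBelow e (λ t → pD₁-at j t ≡ᵇ a))
    to a∈pD₁ =
      let x , _ , x∈D₁∧px≡a = anyBelow⇒∃ p _ (subst T (any-applyUpTo p id _) a∈pD₁)
          x∈D₁ , px≡a      = Equivalence.to T-∧ x∈D₁∧px≡a
          t , t<e , g^ι≡x  = anyBelow⇒∃ e _ (subst T (any-applyUpTo e id _) x∈D₁)
      in ∃⇒anyBelow e _ t<e (ℕ.≡⇒≡ᵇ _ _ (trans (cong (p *_) (ℕ.≡ᵇ⇒≡ _ _ g^ι≡x)) (ℕ.≡ᵇ⇒≡ _ _ px≡a)))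
    from : T (anyBelow e (λ t → pD₁-at j t ≡ᵇ a)) → T (pD₁ j a)
    from a∈image =
      let t , t<e , pD₁-at≡a = anyBelow⇒∃ e _ a∈image
      in subst T (sym (any-applyUpTo p id _))
           (∃⇒anyBelow p _ (m%n<n (g ^ ι₁ j t) p) (Equivalence.from T-∧ (g^ι₁∈D₁ t<e , pD₁-at≡a)))

  Hp≡⋃ : ∀ v a → Hp v a ≡ anyBelow (f / 2) (λ l → anyBelow e (λ t → pD₁-at ((l + v) % f) t ≡ᵇ a))
  Hp≡⋃ v a = trans (any-applyUpTo (f / 2) id _) (anyBelow-cong (f / 2) λ l → pD₁≡image ((l + v) % f) a)

  Hp²≡⋃ : ∀ v a → Hp² v a ≡ anyBelow (p * f / 2) (λ l → anyBelow e (λ t → D₂-at ((l + v) % (p * f)) t ≡ᵇ a))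
  Hp²≡⋃ v a = trans (any-applyUpTo (p * f / 2) id _) (anyBelow-cong (p * f / 2) λ l → D₂≡image ((l + v) % (p * f)) a)

  pD₁-at≢0 : ∀ j t → pD₁-at j t ≢ 0
  pD₁-at≢0 j t p*g^ι≡0 = g^%p≢0 (ι₁ j t) (ℕ.m*n≡0⇒m≡0 _ p (trans (ℕ.*-comm _ p) p*g^ι≡0))

  pD₁-at%p≡0 : ∀ j t → pD₁-at j t % p ≡ 0
  pD₁-at%p≡0 j t = trans (cong (_% p) (ℕ.*-comm p _)) (m*n%n≡0 g^[ ι₁ j t ]%p p)

  D₂-at%p≢0 : ∀ j t → D₂-at j t % p ≢ 0
  D₂-at%p≢0 j t eq = g^%p≢0 (ι₂ j t) (trans (sym (g^%p²%p (ι₂ j t))) eq)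

  Hp-support : ∀ v a → T (Hp v a) → a ≢ 0 × a % p ≡ 0
  Hp-support v a a∈Hp =
    let l , t , pD₁-at≡a = anyBelow²⇒∃ (f / 2) e (λ l → pD₁-at ((l + v) % f)) a (subst T (Hp≡⋃ v a) a∈Hp)
    in (λ a≡0 → pD₁-at≢0 _ t (trans pD₁-at≡a a≡0)) , subst (λ x → x % p ≡ 0) pD₁-at≡a (pD₁-at%p≡0 _ t)

  Hp²-support : ∀ v a → T (Hp² v a) → a % p ≢ 0
  Hp²-support v a a∈Hp² =
    let l , t , D₂-at≡a = anyBelow²⇒∃ (p * f / 2) e (λ l → D₂-at ((l + v) % (p * f))) a (subst T (Hp²≡⋃ v a) a∈Hp²)
    in subst (λ x → x % p ≢ 0) D₂-at≡a (D₂-at%p≢0 _ t)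

  Hp-cong : ∀ {v v′} → v % f ≡ v′ % f → ∀ a → Hp v a ≡ Hp v′ a
  Hp-cong {v} {v′} v≡v′ a = begin
    Hp v a                                                                     ≡⟨ Hp≡⋃ v a ⟩
    anyBelow (f / 2) (λ l → anyBelow e (λ t → pD₁-at ((l + v) % f) t ≡ᵇ a))    ≡⟨ anyBelow-cong (f / 2) (λ l →
                                                                                    cong (λ j → anyBelow e (λ t → pD₁-at j t ≡ᵇ a))
                                                                                         (%-cong-+ f refl v≡v′)) ⟩
    anyBelow (f / 2) (λ l → anyBelow e (λ t → pD₁-at ((l + v′) % f) t ≡ᵇ a))   ≡⟨ Hp≡⋃ v′ a ⟨
    Hp v′ a                                                                    ∎
    where open ≡-Reasoning

  Hp²-cong : ∀ {v v′} → v % (p * f) ≡ v′ % (p * f) → ∀ a → Hp² v a ≡ Hp² v′ a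
  Hp²-cong {v} {v′} v≡v′ a = begin
    Hp² v a                                                                                ≡⟨ Hp²≡⋃ v a ⟩
    anyBelow (p * f / 2) (λ l → anyBelow e (λ t → D₂-at ((l + v) % (p * f)) t ≡ᵇ a))       ≡⟨ anyBelow-cong (p * f / 2) (λ l →
                                                                                                cong (λ j → anyBelow e (λ t → D₂-at j t ≡ᵇ a))
                                                                                                     (%-cong-+ (p * f) refl v≡v′)) ⟩
    anyBelow (p * f / 2) (λ l → anyBelow e (λ t → D₂-at ((l + v′) % (p * f)) t ≡ᵇ a))      ≡⟨ Hp²≡⋃ v′ a ⟨
    Hp² v′ a                                                                               ∎
    where open ≡-Reasoning

  f∣pf : f ∣ p * f
  f∣pf = divides p refl

  ι₁%f : ∀ j t → ι₁ j t % f ≡ j % f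
  ι₁%f j t = trans ([m+d*t]%d≡m%d f (j % f) t) (m%n%n≡m%n j f)

  ι₂%pf : ∀ j t → ι₂ j t % (p * f) ≡ j % (p * f)
  ι₂%pf j t = trans ([m+d*t]%d≡m%d (p * f) (j % (p * f)) t) (m%n%n≡m%n j (p * f))

  %pf%f : ∀ x → x % (p * f) % f ≡ x % f
  %pf%f x = m∣n⇒o%n%m≡o%m f (p * f) x f∣pf

  ι₂%f : ∀ j t → ι₂ j t % f ≡ j % f
  ι₂%f j t = begin
    ι₂ j t % f                ≡⟨ %pf%f (ι₂ j t) ⟨
    ι₂ j t % (p * f) % f      ≡⟨ cong (_% f) (ι₂%pf j t) ⟩
    j % (p * f) % f           ≡⟨ %pf%f j ⟩
    j % f                     ∎
    where open ≡-Reasoning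

  p≡1+[p-1] : p ≡ 1 + (p ∸ 1)
  p≡1+[p-1] = sym (ℕ.m+[n∸m]≡n {1} {p} 0<p)

  offset-regroup : ∀ n l v → n + (l + v) ≡ l + (v + n)
  offset-regroup = solve-∀

  offset-%% : ∀ d .{{_ : NonZero d}} n l v → (n + (l + v) % d % d) % d ≡ (l + (v + n)) % d
  offset-%% d n l v = trans (%-cong-+ d refl (trans (m%n%n≡m%n ((l + v) % d) d) (m%n%n≡m%n (l + v) d)))
                            (cong (_% d) (offset-regroup n l v))

  g^%p-skip : ∀ x t → g^[ x + p * f * t ]%p ≡ g^[ x + f * t ]%p
  g^%p-skip x t = trans (cong g^[_]%p (split-period x t)) (g^%p-periodic-* (x + f * t) (f * t))
    where
    split-period : ∀ x t → x + p * f * t ≡ x + f * t + (p ∸ 1) * (f * t)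
    split-period x t = trans (cong (λ q → x + q * f * t) p≡1+[p-1]) (regroup x (p ∸ 1) f t)
      where
      regroup : ∀ x q f t → x + (1 + q) * f * t ≡ x + f * t + q * (f * t)
      regroup = solve-∀

  f≡f/2*2 : f ≡ f / 2 * 2
  f≡f/2*2 = sym (m/n*n≡m 2∣f)

  p≡1+ef : p ≡ 1 + e * f
  p≡1+ef = trans p≡1+[p-1] (cong suc p-1≡ef)

  pf/2≡f/2+f/2*e*f : p * f / 2 ≡ f / 2 + f / 2 * e * f
  pf/2≡f/2+f/2*e*f = trans (cong (_/ 2) pf≡) (m*n/n≡m (f / 2 + f / 2 * e * f) 2)
    where
    regroup : ∀ e f h → (1 + e * f) * (h * 2) ≡ (h + h * e * f) * 2
    regroup = solve-∀
    pf≡ : p * f ≡ (f / 2 + f / 2 * e * f) * 2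
    pf≡ = trans (cong₂ _*_ p≡1+ef f≡f/2*2) (regroup e f (f / 2))

  module Evaluation {c ℓ : Level} (R : CommutativeRing c ℓ) where

    open CommutativeRing R
      renaming (_+_ to _+ᴿ_; _*_ to _*ᴿ_; _-_ to _-ᴿ_; refl to ≈-refl; sym to ≈-sym; trans to ≈-trans)
    open import Relation.Binary.Reasoning.Setoid setoid
    open import Algebra.Properties.Semiring.Exp semiring using (^-assocʳ; ^-congˡ; ^-homo-*)
    open RangeSum R
    open Eval R using (evalSet; sPoly; _^ᴿ_)

    evalSet≡∑∈ : ∀ S x → evalSet S x ≡ ∑∈ (p * p) S (x ^ᴿ_)
    evalSet≡∑∈ S x = foldr-applyUpTo (p * p) id _

    sPoly≈1+Hp+Hp² : ∀ b x → sPoly b x ≈ 1# +ᴿ (evalSet (Hp b) x +ᴿ evalSet (Hp² b) x)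
    sPoly≈1+Hp+Hp² b x = begin
      sPoly b x                                                        ≡⟨ evalSet≡∑∈ (s b) x ⟩
      ∑∈ (p * p) (s b) (x ^ᴿ_)                                         ≈⟨ ∑∈-cong (p * p) _ reduce ⟩
      ∑∈ (p * p) (λ i → (0 ≡ᵇ i) ∨ (Hp b i ∨ Hp² b i)) (x ^ᴿ_)         ≈⟨ ∑∈-∨ (p * p) _ _ _ (λ i _ → 0∉Hp∪Hp² i) ⟩
      ∑∈ (p * p) (0 ≡ᵇ_) (x ^ᴿ_) +ᴿ ∑∈ (p * p) (λ i → Hp b i ∨ Hp² b i) (x ^ᴿ_)
                                                                       ≈⟨ +-cong (∑∈-singleton (p * p) 0 _ 0<p²)
                                                                                 (∑∈-∨ (p * p) _ _ _ (λ i _ → Hp∩Hp²≡∅ i)) ⟩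
      1# +ᴿ (∑∈ (p * p) (Hp b) (x ^ᴿ_) +ᴿ ∑∈ (p * p) (Hp² b) (x ^ᴿ_))   ≡⟨ cong₂ (λ u w → 1# +ᴿ (u +ᴿ w)) (evalSet≡∑∈ _ x)
                                                                                 (evalSet≡∑∈ _ x) ⟨
      1# +ᴿ (evalSet (Hp b) x +ᴿ evalSet (Hp² b) x)                    ∎
      where
      0<p² : 0 < p * p
      0<p² = ℕ.*-mono-< {0} {p} {0} {p} 0<p 0<p
      reduce : ∀ i → i < p * p → s b i ≡ (0 ≡ᵇ i) ∨ (Hp b i ∨ Hp² b i)
      reduce i i<p² = trans (cong (C₁ b) (m<n⇒m%n≡m i<p²)) (cong (_∨ (Hp b i ∨ Hp² b i)) (≡ᵇ0-comm i))
        where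
        ≡ᵇ0-comm : ∀ i → (i ≡ᵇ 0) ≡ (0 ≡ᵇ i)
        ≡ᵇ0-comm zero    = refl
        ≡ᵇ0-comm (suc i) = refl
      0∉Hp∪Hp² : ∀ i → T (0 ≡ᵇ i) → T (Hp b i ∨ Hp² b i) → ⊥
      0∉Hp∪Hp² zero _ 0∈Hp∪Hp² with Equivalence.to T-∨ 0∈Hp∪Hp²
      ... | inj₁ 0∈Hp  = proj₁ (Hp-support b 0 0∈Hp) refl
      ... | inj₂ 0∈Hp² = Hp²-support b 0 0∈Hp² (m<n⇒m%n≡m 0<p)
      Hp∩Hp²≡∅ : ∀ i → T (Hp b i) → T (Hp² b i) → ⊥
      Hp∩Hp²≡∅ i i∈Hp i∈Hp² = Hp²-support b i i∈Hp² (proj₂ (Hp-support b i i∈Hp))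

    evalSet-Hp : ∀ v x → evalSet (Hp v) x ≈ ∑[ l < f / 2 ] ∑[ t < e ] (x ^ᴿ pD₁-at ((l + v) % f) t)
    evalSet-Hp v x = begin
      evalSet (Hp v) x                                                                ≡⟨ evalSet≡∑∈ _ x ⟩
      ∑∈ (p * p) (Hp v) (x ^ᴿ_)                                                       ≈⟨ ∑∈-cong (p * p) _ (λ a _ → Hp≡⋃ v a) ⟩
      ∑∈ (p * p) (λ a → anyBelow (f / 2) λ l → anyBelow e λ t → pD₁-at ((l + v) % f) t ≡ᵇ a) (x ^ᴿ_)
                                                                                      ≈⟨ ∑∈-⋃-images (p * p) (f / 2) e _ (x ^ᴿ_)
                                                                                           (λ l t _ _ → pD₁-at<p² _ t) (pD₁-at-injective v) ⟩
      ∑[ l < f / 2 ] ∑[ t < e ] (x ^ᴿ pD₁-at ((l + v) % f) t)                         ∎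

    evalSet-Hp² : ∀ v x → evalSet (Hp² v) x ≈ ∑[ l < p * f / 2 ] ∑[ t < e ] (x ^ᴿ D₂-at ((l + v) % (p * f)) t)
    evalSet-Hp² v x = begin
      evalSet (Hp² v) x                                                               ≡⟨ evalSet≡∑∈ _ x ⟩
      ∑∈ (p * p) (Hp² v) (x ^ᴿ_)                                                      ≈⟨ ∑∈-cong (p * p) _ (λ a _ → Hp²≡⋃ v a) ⟩
      ∑∈ (p * p) (λ a → anyBelow (p * f / 2) λ l → anyBelow e λ t → D₂-at ((l + v) % (p * f)) t ≡ᵇ a) (x ^ᴿ_)
                                                                                      ≈⟨ ∑∈-⋃-images (p * p) (p * f / 2) e _ (x ^ᴿ_)
                                                                                           (λ l t _ _ → D₂-at<p² _ t) (D₂-at-injective v) ⟩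
      ∑[ l < p * f / 2 ] ∑[ t < e ] (x ^ᴿ D₂-at ((l + v) % (p * f)) t)                ∎

    1^n≈1 : ∀ n → 1# ^ᴿ n ≈ 1#
    1^n≈1 zero    = ≈-refl
    1^n≈1 (suc n) = ≈-trans (*-identityˡ _) (1^n≈1 n)

    evalSet-cong : ∀ {S S′ : ℕ → Bool} x → (∀ a → S a ≡ S′ a) → evalSet S x ≈ evalSet S′ x
    evalSet-cong {S} {S′} x S≡S′ = begin
      evalSet S x                ≡⟨ evalSet≡∑∈ S x ⟩
      ∑∈ (p * p) S (x ^ᴿ_)       ≈⟨ ∑∈-cong (p * p) _ (λ a _ → S≡S′ a) ⟩
      ∑∈ (p * p) S′ (x ^ᴿ_)      ≡⟨ evalSet≡∑∈ S′ x ⟨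
      evalSet S′ x               ∎

    ∑∑-const : ∀ m n → ∑[ l < m ] ∑[ t < n ] 1# ≈ ∑[ i < m * n ] 1#
    ∑∑-const m n = ≈-sym (∑-blocks m n (λ _ → 1#))

    evalSet-Hp-at-pth-root : ∀ v x → x ^ᴿ p ≈ 1# → evalSet (Hp v) x ≈ ∑[ i < f / 2 * e ] 1#
    evalSet-Hp-at-pth-root v x xᵖ≈1 = begin
      evalSet (Hp v) x                                          ≈⟨ evalSet-Hp v x ⟩
      ∑[ l < f / 2 ] ∑[ t < e ] (x ^ᴿ pD₁-at ((l + v) % f) t)   ≈⟨ ∑-cong (f / 2) (λ l _ → ∑-cong e λ t _ → x^[p*y]≈1 _) ⟩
      ∑[ l < f / 2 ] ∑[ t < e ] 1#                              ≈⟨ ∑∑-const (f / 2) e ⟩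
      ∑[ i < f / 2 * e ] 1#                                     ∎
      where
      x^[p*y]≈1 : ∀ y → x ^ᴿ (p * y) ≈ 1#
      x^[p*y]≈1 y = ≈-trans (≈-sym (^-assocʳ x p y)) (≈-trans (^-congˡ y xᵖ≈1) (1^n≈1 y))

    evalSet-Hp²-at-1 : ∀ v → evalSet (Hp² v) 1# ≈ ∑[ i < p * f / 2 * e ] 1#
    evalSet-Hp²-at-1 v = begin
      evalSet (Hp² v) 1#                                                   ≈⟨ evalSet-Hp² v 1# ⟩
      ∑[ l < p * f / 2 ] ∑[ t < e ] (1# ^ᴿ D₂-at ((l + v) % (p * f)) t)    ≈⟨ ∑-cong (p * f / 2) (λ l _ → ∑-cong e λ t _ → 1^n≈1 (D₂-at _ t)) ⟩
      ∑[ l < p * f / 2 ] ∑[ t < e ] 1#                                     ≈⟨ ∑∑-const (p * f / 2) e ⟩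
      ∑[ i < p * f / 2 * e ] 1#                                            ∎

    module AtPrimitiveRoot (R-field : IsFieldChar2 R) (β : Carrier) (β-primitive : IsPrimitiveRoot R (p * p) β) where

      open import Algebra.Properties.Ring ring using (x∙y⁻¹≈ε⇒x≈y)
      open CharacteristicTwo (proj₂ (proj₂ R-field))

      β^-mod : ∀ x → β ^ᴿ x ≈ β ^ᴿ (x % (p * p))
      β^-mod x = begin
        β ^ᴿ x                                                   ≡⟨ cong (β ^ᴿ_) (trans (m≡m%n+[m/n]*n x (p * p))
                                                                                        (cong (x % (p * p) +_) (ℕ.*-comm (x / (p * p)) (p * p)))) ⟩
        β ^ᴿ (x % (p * p) + p * p * (x / (p * p)))               ≈⟨ ^-homo-* β (x % (p * p)) _ ⟩
        β ^ᴿ (x % (p * p)) *ᴿ β ^ᴿ (p * p * (x / (p * p)))       ≈⟨ *-congˡ (^-assocʳ β (p * p) (x / (p * p))) ⟨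
        β ^ᴿ (x % (p * p)) *ᴿ (β ^ᴿ (p * p)) ^ᴿ (x / (p * p))    ≈⟨ *-congˡ (≈-trans (^-congˡ (x / (p * p)) (proj₁ β-primitive))
                                                                                     (1^n≈1 (x / (p * p)))) ⟩
        β ^ᴿ (x % (p * p)) *ᴿ 1#                                 ≈⟨ *-identityʳ _ ⟩
        β ^ᴿ (x % (p * p))                                       ∎

      β^-reduce : ∀ {x y} → x % (p * p) ≡ y → β ^ᴿ x ≈ β ^ᴿ y
      β^-reduce {x} x%p²≡y = ≈-trans (β^-mod x) (reflexive (cong (β ^ᴿ_) x%p²≡y))

      η₁ : ℕ → Carrier
      η₁ w = ∑[ t < e ] (β ^ᴿ (p * g^[ w + f * t ]%p))

      η₂ : ℕ → Carrier
      η₂ w = ∑[ t < e ] (β ^ᴿ g^[ w + p * f * t ]%p²)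

      η₁-cong : ∀ {w w′} → w % f ≡ w′ % f → η₁ w ≈ η₁ w′
      η₁-cong = ∑-progression-cong f e (λ x → β ^ᴿ (p * g^[ x ]%p)) periodic
        where
        periodic : ∀ x → β ^ᴿ (p * g^[ x + f * e ]%p) ≈ β ^ᴿ (p * g^[ x ]%p)
        periodic x = reflexive (cong (λ y → β ^ᴿ (p * y))
          (trans (cong (λ k → g^[ x + k ]%p) (trans (ℕ.*-comm f e) (sym p-1≡ef))) (g^%p-periodic x)))

      η₂-cong : ∀ {w w′} → w % (p * f) ≡ w′ % (p * f) → η₂ w ≈ η₂ w′
      η₂-cong = ∑-progression-cong (p * f) e (λ x → β ^ᴿ g^[ x ]%p²) periodic
        where
        periodic : ∀ x → β ^ᴿ g^[ x + p * f * e ]%p² ≈ β ^ᴿ g^[ x ]%p²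
        periodic x = reflexive (cong (β ^ᴿ_) (trans (cong (λ k → g^[ x + k ]%p²) (sym ord≡pf*e)) (g^%p²-periodic x)))

      evalSet-Hp-at-β : ∀ v → evalSet (Hp v) β ≈ ∑[ l < f / 2 ] η₁ (l + v)
      evalSet-Hp-at-β v = ≈-trans (evalSet-Hp v β) (∑-cong (f / 2) λ l _ → η₁-cong {(l + v) % f % f} (trans (m%n%n≡m%n _ f) (m%n%n≡m%n _ f)))

      evalSet-Hp²-at-β : ∀ v → evalSet (Hp² v) β ≈ ∑[ l < p * f / 2 ] η₂ (l + v)
      evalSet-Hp²-at-β v = ≈-trans (evalSet-Hp² v β) (∑-cong (p * f / 2) λ l _ → η₂-cong {(l + v) % (p * f) % (p * f)} (trans (m%n%n≡m%n _ (p * f)) (m%n%n≡m%n _ (p * f))))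

      -- m ↦ g^m mod p permutes 1 … p-1, so this is the sum of the p-th roots of unity other than 1.
      ∑-β^p*g^%p : ∑[ m < p ∸ 1 ] (β ^ᴿ (p * g^[ m ]%p)) ≈ 1#
      ∑-β^p*g^%p = 1+x≈0⇒x≈1 _ (begin
        1# +ᴿ ∑[ m < p ∸ 1 ] (β ^ᴿ (p * g^[ m ]%p))          ≈⟨ +-congˡ (∑-cong (p ∸ 1) λ m _ → reflexive (cong (λ y → β ^ᴿ (p * y)) (sym (suc-pred m)))) ⟩
        1# +ᴿ ∑[ m < p ∸ 1 ] (β ^ᴿ (p * suc (g^[ m ]%p ∸ 1))) ≈⟨ +-congˡ (∑-permute (p ∸ 1) (λ m → g^[ m ]%p ∸ 1) (λ y → β ^ᴿ (p * suc y))
                                                                         (λ m _ → g^%p∸1<p-1 m) g^%p∸1-injective) ⟩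
        1# +ᴿ ∑[ y < p ∸ 1 ] (β ^ᴿ (p * suc y))               ≈⟨ +-congʳ (reflexive (cong (β ^ᴿ_) (sym (ℕ.*-zeroʳ p)))) ⟩
        ∑ (suc (p ∸ 1)) (λ y → β ^ᴿ (p * y))                  ≡⟨ cong (λ n → ∑ n (λ y → β ^ᴿ (p * y))) (sym p≡1+[p-1]) ⟩
        ∑[ y < p ] (β ^ᴿ (p * y))                             ≈⟨ ∑-cong p (λ y _ → ^-assocʳ β p y) ⟨
        ∑[ y < p ] ((β ^ᴿ p) ^ᴿ y)                            ≈⟨ ∑-geometric p (β ^ᴿ p) ζᵖ≈1 ζ-1-invertible ⟩
        0#                                                    ∎)
        where
        suc-pred : ∀ m → suc (g^[ m ]%p ∸ 1) ≡ g^[ m ]%p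
        suc-pred m = ℕ.m+[n∸m]≡n (1≤g^%p m)
        ζᵖ≈1 : (β ^ᴿ p) ^ᴿ p ≈ 1#
        ζᵖ≈1 = ≈-trans (^-assocʳ β p p) (proj₁ β-primitive)
        ζ≉1 : ¬ β ^ᴿ p ≈ 1#
        ζ≉1 = proj₂ β-primitive p 0<p (subst (_< p * p) (ℕ.*-identityˡ p) (ℕ.*-monoˡ-< p 1<p))
        ζ-1-invertible : ∃ λ y → (β ^ᴿ p -ᴿ 1#) *ᴿ y ≈ 1#
        ζ-1-invertible = proj₁ (proj₂ R-field) _ (ζ≉1 ∘ x∙y⁻¹≈ε⇒x≈y _ _)

      ∑-η₁-period : ∀ w → ∑[ l < f ] η₁ (w + l) ≈ 1#
      ∑-η₁-period w = begin
        ∑[ l < f ] ∑[ t < e ] Φ ((w + l) + f * t)        ≈⟨ ∑-swap f e _ ⟩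
        ∑[ t < e ] ∑[ l < f ] Φ ((w + l) + f * t)        ≈⟨ ∑-cong e (λ t _ → ∑-cong f λ l _ → reflexive (cong Φ (regroup w l (f * t)))) ⟩
        ∑[ t < e ] ∑[ l < f ] Φ (w + (f * t + l))        ≈⟨ ∑-blocks e f (λ m → Φ (w + m)) ⟨
        ∑[ m < e * f ] Φ (w + m)                         ≡⟨ cong (λ n → ∑[ m < n ] Φ (w + m)) (sym p-1≡ef) ⟩
        ∑[ m < p ∸ 1 ] Φ (w + m)                         ≈⟨ ∑-shift-periodic (p ∸ 1) w Φ (λ x → reflexive (cong (λ y → β ^ᴿ (p * y)) (g^%p-periodic x))) ⟩
        ∑[ m < p ∸ 1 ] Φ m                               ≈⟨ ∑-β^p*g^%p ⟩
        1#                                               ∎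
        where
        Φ : ℕ → Carrier
        Φ x = β ^ᴿ (p * g^[ x ]%p)
        regroup : ∀ w l x → (w + l) + x ≡ w + (x + l)
        regroup = solve-∀

      ∑-η₁-long : ∀ w → ∑[ l < p * f / 2 ] η₁ (l + w) ≈ ∑[ l < f / 2 ] η₁ (l + w) +ᴿ ∑[ i < f / 2 * e ] 1#
      ∑-η₁-long w = begin
        ∑[ l < p * f / 2 ] η₁ (l + w)                                              ≡⟨ cong (λ n → ∑[ l < n ] η₁ (l + w)) pf/2≡f/2+f/2*e*f ⟩
        ∑[ l < f / 2 + f / 2 * e * f ] η₁ (l + w)                                  ≈⟨ ∑-split (f / 2) (f / 2 * e * f) _ ⟩
        ∑[ l < f / 2 ] η₁ (l + w) +ᴿ ∑[ i < f / 2 * e * f ] η₁ (f / 2 + i + w)    ≈⟨ +-congˡ (∑-blocks (f / 2 * e) f _) ⟩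
        ∑[ l < f / 2 ] η₁ (l + w) +ᴿ ∑[ t < f / 2 * e ] ∑[ l < f ] η₁ (f / 2 + (f * t + l) + w)
                                                                                   ≈⟨ +-congˡ (∑-cong (f / 2 * e) λ t _ → full-period t) ⟩
        ∑[ l < f / 2 ] η₁ (l + w) +ᴿ ∑[ t < f / 2 * e ] 1#                         ∎
        where
        regroup : ∀ h x l w → h + (x + l) + w ≡ h + x + w + l
        regroup = solve-∀
        full-period : ∀ t → ∑[ l < f ] η₁ (f / 2 + (f * t + l) + w) ≈ 1#
        full-period t = ≈-trans (∑-cong f λ l _ → reflexive (cong η₁ (regroup (f / 2) (f * t) l w))) (∑-η₁-period (f / 2 + f * t + w))

      evalSet-Hp-at-g^ : ∀ v n → evalSet (Hp v) (β ^ᴿ g^[ n ]%p²) ≈ evalSet (Hp (v + n)) β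
      evalSet-Hp-at-g^ v n = begin
        evalSet (Hp v) (β ^ᴿ g^[ n ]%p²)                                          ≈⟨ evalSet-Hp v _ ⟩
        ∑[ l < f / 2 ] ∑[ t < e ] ((β ^ᴿ g^[ n ]%p²) ^ᴿ pD₁-at ((l + v) % f) t)   ≈⟨ ∑-cong (f / 2) (λ l _ → ∑-cong e λ t _ → multiply _ t) ⟩
        ∑[ l < f / 2 ] η₁ (n + (l + v) % f % f)                                   ≈⟨ ∑-cong (f / 2) (λ l _ → η₁-cong (offset-%% f n l v)) ⟩
        ∑[ l < f / 2 ] η₁ (l + (v + n))                                           ≈⟨ evalSet-Hp-at-β (v + n) ⟨
        evalSet (Hp (v + n)) β                                                    ∎
        where
        multiply : ∀ j t → (β ^ᴿ g^[ n ]%p²) ^ᴿ pD₁-at j t ≈ β ^ᴿ (p * g^[ n + j % f + f * t ]%p)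
        multiply j t = ≈-trans (^-assocʳ β g^[ n ]%p² (pD₁-at j t)) (β^-reduce (trans (g^%p²-*-p*g^%p n (ι₁ j t))
                                                                  (cong (λ k → p * g^[ k ]%p) (sym (ℕ.+-assoc n (j % f) (f * t))))))

      evalSet-Hp²-at-g^ : ∀ v n → evalSet (Hp² v) (β ^ᴿ g^[ n ]%p²) ≈ evalSet (Hp² (v + n)) β
      evalSet-Hp²-at-g^ v n = begin
        evalSet (Hp² v) (β ^ᴿ g^[ n ]%p²)                                                    ≈⟨ evalSet-Hp² v _ ⟩
        ∑[ l < p * f / 2 ] ∑[ t < e ] ((β ^ᴿ g^[ n ]%p²) ^ᴿ D₂-at ((l + v) % (p * f)) t)     ≈⟨ ∑-cong (p * f / 2) (λ l _ → ∑-cong e λ t _ → multiply _ t) ⟩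
        ∑[ l < p * f / 2 ] η₂ (n + (l + v) % (p * f) % (p * f))                              ≈⟨ ∑-cong (p * f / 2) (λ l _ → η₂-cong (offset-%% (p * f) n l v)) ⟩
        ∑[ l < p * f / 2 ] η₂ (l + (v + n))                                                  ≈⟨ evalSet-Hp²-at-β (v + n) ⟨
        evalSet (Hp² (v + n)) β                                                              ∎
        where
        multiply : ∀ j t → (β ^ᴿ g^[ n ]%p²) ^ᴿ D₂-at j t ≈ β ^ᴿ g^[ n + j % (p * f) + p * f * t ]%p²
        multiply j t = ≈-trans (^-assocʳ β g^[ n ]%p² (D₂-at j t)) (β^-reduce (trans (g^%p²-*-g^%p² n (ι₂ j t))
                                                                  (cong g^[_]%p² (sym (ℕ.+-assoc n (j % (p * f)) (p * f * t))))))

      evalSet-Hp²-at-p*g^ : ∀ v n → evalSet (Hp² v) (β ^ᴿ (p * g^[ n ]%p)) ≈ evalSet (Hp (v + n)) β +ᴿ ∑[ i < f / 2 * e ] 1#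
      evalSet-Hp²-at-p*g^ v n = begin
        evalSet (Hp² v) (β ^ᴿ (p * g^[ n ]%p))                                                  ≈⟨ evalSet-Hp² v _ ⟩
        ∑[ l < p * f / 2 ] ∑[ t < e ] ((β ^ᴿ (p * g^[ n ]%p)) ^ᴿ D₂-at ((l + v) % (p * f)) t)   ≈⟨ ∑-cong (p * f / 2) (λ l _ → ∑-cong e λ t _ → multiply _ t) ⟩
        ∑[ l < p * f / 2 ] η₁ (n + (l + v) % (p * f) % (p * f))                                 ≈⟨ ∑-cong (p * f / 2) (λ l _ → η₁-cong (offset l)) ⟩
        ∑[ l < p * f / 2 ] η₁ (l + (v + n))                                                     ≈⟨ ∑-η₁-long (v + n) ⟩
        ∑[ l < f / 2 ] η₁ (l + (v + n)) +ᴿ ∑[ i < f / 2 * e ] 1#                                ≈⟨ +-congʳ (evalSet-Hp-at-β (v + n)) ⟨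
        evalSet (Hp (v + n)) β +ᴿ ∑[ i < f / 2 * e ] 1#                                         ∎
        where
        multiply : ∀ j t → (β ^ᴿ (p * g^[ n ]%p)) ^ᴿ D₂-at j t ≈ β ^ᴿ (p * g^[ n + j % (p * f) + f * t ]%p)
        multiply j t = ≈-trans (^-assocʳ β (p * g^[ n ]%p) (D₂-at j t)) (β^-reduce (trans (p*g^%p-*-g^%p² n (ι₂ j t)) (cong (p *_)
          (trans (cong g^[_]%p (sym (ℕ.+-assoc n (j % (p * f)) (p * f * t)))) (g^%p-skip (n + j % (p * f)) t)))))
        offset : ∀ l → (n + (l + v) % (p * f) % (p * f)) % f ≡ (l + (v + n)) % f
        offset l = trans (%-cong-+ f refl (trans (cong (_% f) (m%n%n≡m%n (l + v) (p * f))) (%pf%f (l + v))))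
                         (cong (_% f) (offset-regroup n l v))

      sPoly-at-1 : ∀ b → sPoly b 1# ≈ 1#
      sPoly-at-1 b = begin
        sPoly b 1#                                                        ≈⟨ sPoly≈1+Hp+Hp² b 1# ⟩
        1# +ᴿ (evalSet (Hp b) 1# +ᴿ evalSet (Hp² b) 1#)                   ≈⟨ +-congˡ (+-cong (evalSet-Hp-at-pth-root b 1# (1^n≈1 p)) (evalSet-Hp²-at-1 b)) ⟩
        1# +ᴿ (∑[ i < f / 2 * e ] 1# +ᴿ ∑[ i < p * f / 2 * e ] 1#)        ≈⟨ +-congˡ (∑-split (f / 2 * e) (p * f / 2 * e) _) ⟨
        1# +ᴿ ∑[ i < f / 2 * e + p * f / 2 * e ] 1#                       ≡⟨ cong (λ n → 1# +ᴿ ∑[ i < n ] 1#) |Hp|+|Hp²|-even ⟩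
        1# +ᴿ ∑[ i < half-count + half-count ] 1#                         ≈⟨ +-congˡ (∑-double half-count 1#) ⟩
        1# +ᴿ 0#                                                          ≈⟨ +-identityʳ 1# ⟩
        1#                                                                ∎
        where
        half-count : ℕ
        half-count = f / 2 * e + f / 2 * e * (f / 2 * e)
        regroup : ∀ h e → h * e + (h + h * e * (h * 2)) * e ≡ (h * e + h * e * (h * e)) + (h * e + h * e * (h * e))
        regroup = solve-∀
        |Hp|+|Hp²|-even : f / 2 * e + p * f / 2 * e ≡ half-count + half-count
        |Hp|+|Hp²|-even = trans (cong (λ m → f / 2 * e + m * e) (trans pf/2≡f/2+f/2*e*f (cong (λ f′ → f / 2 + f / 2 * e * f′) f≡f/2*2)))
                                (regroup (f / 2) e)

      sPoly-at-p*g^ : ∀ b n → sPoly b (β ^ᴿ (p * g^[ n ]%p)) ≈ 1# +ᴿ evalSet (Hp (b + n)) β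
      sPoly-at-p*g^ b n = begin
        sPoly b x                                                             ≈⟨ sPoly≈1+Hp+Hp² b x ⟩
        1# +ᴿ (evalSet (Hp b) x +ᴿ evalSet (Hp² b) x)                         ≈⟨ +-congˡ (+-cong (evalSet-Hp-at-pth-root b x xᵖ≈1) (evalSet-Hp²-at-p*g^ b n)) ⟩
        1# +ᴿ (∑[ i < f / 2 * e ] 1# +ᴿ (evalSet (Hp (b + n)) β +ᴿ ∑[ i < f / 2 * e ] 1#))
                                                                              ≈⟨ +-congˡ (x+[y+x]≈y _ _) ⟩
        1# +ᴿ evalSet (Hp (b + n)) β                                          ∎
        where
        x : Carrier
        x = β ^ᴿ (p * g^[ n ]%p)
        regroup : ∀ p y → p * y * p ≡ y * (p * p)
        regroup = solve-∀
        xᵖ≈1 : x ^ᴿ p ≈ 1#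
        xᵖ≈1 = ≈-trans (^-assocʳ β (p * g^[ n ]%p) p) (β^-reduce (trans (cong (_% (p * p)) (regroup p g^[ n ]%p)) (m*n%n≡0 g^[ n ]%p (p * p))))

      sPoly-at-g^ : ∀ b n → sPoly b (β ^ᴿ g^[ n ]%p²) ≈ (1# +ᴿ evalSet (Hp (b + n)) β) +ᴿ evalSet (Hp² (b + n)) β
      sPoly-at-g^ b n = begin
        sPoly b x                                                             ≈⟨ sPoly≈1+Hp+Hp² b x ⟩
        1# +ᴿ (evalSet (Hp b) x +ᴿ evalSet (Hp² b) x)                         ≈⟨ +-congˡ (+-cong (evalSet-Hp-at-g^ b n) (evalSet-Hp²-at-g^ b n)) ⟩
        1# +ᴿ (evalSet (Hp (b + n)) β +ᴿ evalSet (Hp² (b + n)) β)             ≈⟨ +-assoc _ _ _ ⟨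
        (1# +ᴿ evalSet (Hp (b + n)) β) +ᴿ evalSet (Hp² (b + n)) β             ∎
        where
        x : Carrier
        x = β ^ᴿ g^[ n ]%p²

      sPoly-at-pD₁ : ∀ b k a → T (pD₁ k a) → sPoly b (β ^ᴿ a) ≈ 1# +ᴿ evalSet (Hp (b + k)) β
      sPoly-at-pD₁ b k a a∈pD₁ =
        let t , _ , pD₁-at≡a = anyBelow⇒∃ e _ (subst T (pD₁≡image k a) a∈pD₁)
        in begin
          sPoly b (β ^ᴿ a)                      ≡⟨ cong (λ y → sPoly b (β ^ᴿ y)) (ℕ.≡ᵇ⇒≡ (pD₁-at k t) a pD₁-at≡a) ⟨
          sPoly b (β ^ᴿ pD₁-at k t)             ≈⟨ sPoly-at-p*g^ b (ι₁ k t) ⟩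
          1# +ᴿ evalSet (Hp (b + ι₁ k t)) β     ≈⟨ +-congˡ (evalSet-cong β (Hp-cong (%-cong-+ f refl (ι₁%f k t)))) ⟩
          1# +ᴿ evalSet (Hp (b + k)) β          ∎

      sPoly-at-D₂ : ∀ b k a → T (D₂ k a) → sPoly b (β ^ᴿ a) ≈ (1# +ᴿ evalSet (Hp (b + k)) β) +ᴿ evalSet (Hp² (b + k)) β
      sPoly-at-D₂ b k a a∈D₂ =
        let t , _ , D₂-at≡a = anyBelow⇒∃ e _ (subst T (D₂≡image k a) a∈D₂)
        in begin
          sPoly b (β ^ᴿ a)                                                           ≡⟨ cong (λ y → sPoly b (β ^ᴿ y)) (ℕ.≡ᵇ⇒≡ (D₂-at k t) a D₂-at≡a) ⟨
          sPoly b (β ^ᴿ D₂-at k t)                                                   ≈⟨ sPoly-at-g^ b (ι₂ k t) ⟩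
          (1# +ᴿ evalSet (Hp (b + ι₂ k t)) β) +ᴿ evalSet (Hp² (b + ι₂ k t)) β        ≈⟨ +-cong (+-congˡ (evalSet-cong β (Hp-cong (%-cong-+ f refl (ι₂%f k t)))))
                                                                                                (evalSet-cong β (Hp²-cong (%-cong-+ (p * f) refl (ι₂%pf k t)))) ⟩
          (1# +ᴿ evalSet (Hp (b + k)) β) +ᴿ evalSet (Hp² (b + k)) β                  ∎

2∣2^[1+r] : ∀ r → 1 ≤ r → 2 ∣ 2 ^ r
2∣2^[1+r] (suc r) _ = m∣m*n (2 ^ r)

proposition1 : {c ℓ : Level} (p e f r g b : ℕ) .{{_ : NonZero p}} .{{_ : NonZero f}}
    → Prime p → 2 < p
    → p ∸ 1 ≡ e * f → f ≡ 2 ^ r → 1 ≤ r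
    → IsPrimitiveRootModSq p g
    → b < p * f
    → (R : CommutativeRing c ℓ) → IsFieldChar2 R
    → (β : CommutativeRing.Carrier R) → IsPrimitiveRoot R (p * p) β
    → let open Setup p e f g
          open Eval R
      in ∀ k a → k < p * f → a < p * p
         → (a ≡ 0 → sPoly b (β ^ᴿ a) ≈ 1#)
         × (T (pD₁ k a) → sPoly b (β ^ᴿ a) ≈ (1# +ᴿ evalSet (Hp (b + k)) β))
         × (T (D₂ k a) → sPoly b (β ^ᴿ a)
                           ≈ ((1# +ᴿ evalSet (Hp (b + k)) β) +ᴿ evalSet (Hp² (b + k)) β))
proposition1 p e f r g b p-prime _ p-1≡ef f≡2^r 1≤r g-primitive _ R R-field β β-primitive k a _ _ =
  (λ { refl → sPoly-at-1 b }) , sPoly-at-pD₁ b k a , sPoly-at-D₂ b k a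
  where
  open Cyclotomy p e f g p-prime p-1≡ef (subst (2 ∣_) (sym f≡2^r) (2∣2^[1+r] r 1≤r)) g-primitive
  open Evaluation R
  open AtPrimitiveRoot R-field β β-primitive
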